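{- Let $k,w\ge 3$ be integers with $w\ge 2k(k+2)$. Let $W$ be a cylindrical wall of order $w$ with nested cycles $C_1,\dots,C_w$ and horizontal paths $P^1_1,P^2_1,\dots,P^1_w,P^2_w$. Let $A$ be a set of $k$ vertices of $W$ contained in pairwise distinct nested cycles, and let $B\subseteq V(P^1_1)$ be a set of $k$ vertices also contained in pairwise distinct nested cycles. Then there is a set of $k$ pairwise vertex-disjoint directed paths from $A$ to $B$ in $W$.
   Context: The cylindrical grid of order $r$ has vertices $v^i_j$ ($1\le i\le r$, $0\le j\le 2r-1$) and edges $(v^i_j,v^i_{j+1\bmod 2r})$, $(v^i_{2j},v^{i+1}_{2j})$ and $(v^{i+1}_{2j+1},v^i_{2j+1})$ for $1\le i<r$, $0\le j<r$. The elementary cylindrical wall of order $r$ is obtained by splitting each $v^i_j$ with $1<i<r$ into $v_{in},v_{out}$ joined by $(v_{in},v_{out})$, in-edges entering $v_{in}$ and out-edges leaving $v_{out}$. A cylindrical wall of order $r$ is a subdivision of the elementary cylindrical wall of order $r$. Its nested cycles $C_1,\dots,C_r$ are the images of the cycles through $v^i_0,\dots,v^i_{2r-1}$; its horizontal paths are the images of the paths through $v^1_j,\dots,v^r_j$, where for $b\in[r]$, $P^1_b$ corresponds to $j=2(b-1)$ and $P^2_b$ to $j=2b-1$. A set of $k$ paths from $A$ to $B$ means each path starts in $A$ and ends in $B$. -}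

module Defs where

open import Data.Nat using (ℕ; zero; suc; _+_; _*_; _<_; _%_)
open import Data.Fin using (Fin; toℕ)
open import Data.Maybe using (Maybe; just; nothing)
open import Data.Product using (_×_; Σ; ∃; ∃-syntax; _,_)
open import Data.List using (List; []; _∷_)
open import Data.List.NonEmpty using (List⁺; _∷_; toList; head; last)
open import Data.List.Relation.Unary.Unique.Propositional using (Unique)
open import Data.List.Membership.Propositional using (_∈_)
open import Relation.Binary.PropositionalEquality using (_≡_; _≢_)
open import Relation.Nullary using (¬_; Dec; yes; no)
open import Data.Nat using (_<?_)
open import Relation.Nullary.Decidable using (_×-dec_)

-- Elementary cylindrical wall of order r.
-- Rows i : Fin r are 0-based (row toℕ i + 1 of the paper),
-- columns j : Fin (2 * r) are the paper's j.

-- row i is a "middle" row (paper: 1 < i < r), i.e. it gets split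
Mid : (r : ℕ) → Fin r → Set
Mid r i = (0 < toℕ i) × (suc (toℕ i) < r)

mid? : (r : ℕ) (i : Fin r) → Dec (Mid r i)
mid? r i = (0 <? toℕ i) ×-dec (suc (toℕ i) <? r)

-- vertices: v i j is v^i_j for boundary rows and v^i_j,in for middle rows;
-- v' i j m is v^i_j,out (only for middle rows)
data EV (r : ℕ) : Set where
  v  : Fin r → Fin (2 * r) → EV r
  v' : (i : Fin r) → Fin (2 * r) → Mid r i → EV r

vin : (r : ℕ) → Fin r → Fin (2 * r) → EV r
vin r i j = v i j

vout : (r : ℕ) → Fin r → Fin (2 * r) → EV r
vout r i j with mid? r i
... | yes m = v' i j m
... | no _  = v i j

data EE (r : ℕ) : EV r → EV r → Set where
  cyc     : (i : Fin r) (j j' : Fin (2 * r)) → toℕ j' ≡ suc (toℕ j) →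
            EE r (vout r i j) (vin r i j')
  cycwrap : (i : Fin r) (j j' : Fin (2 * r)) → suc (toℕ j) ≡ 2 * r → toℕ j' ≡ 0 →
            EE r (vout r i j) (vin r i j')
  split   : (i : Fin r) (j : Fin (2 * r)) (m : Mid r i) → EE r (v i j) (v' i j m)
  down    : (i i' : Fin r) (j : Fin (2 * r)) → toℕ i' ≡ suc (toℕ i) → toℕ j % 2 ≡ 0 →
            EE r (vout r i j) (vin r i' j)
  up      : (i i' : Fin r) (j : Fin (2 * r)) → toℕ i' ≡ suc (toℕ i) → toℕ j % 2 ≡ 1 →
            EE r (vout r i' j) (vin r i j)

vrow : {r : ℕ} → EV r → Fin r
vrow (v i j) = i
vrow (v' i j m) = i

vcol : {r : ℕ} → EV r → Fin (2 * r)
vcol (v i j) = j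
vcol (v' i j m) = j

edgeRow : {r : ℕ} {x y : EV r} → EE r x y → Maybe (Fin r)
edgeRow (cyc i j j' _) = just i
edgeRow (cycwrap i j j' _ _) = just i
edgeRow (split i j m) = just i
edgeRow (down i i' j _ _) = nothing
edgeRow (up i i' j _ _) = nothing

edgeCol : {r : ℕ} {x y : EV r} → EE r x y → Maybe (Fin (2 * r))
edgeCol (cyc i j j' _) = nothing
edgeCol (cycwrap i j j' _ _) = nothing
edgeCol (split i j m) = just j
edgeCol (down i i' j _ _) = just j
edgeCol (up i i' j _ _) = just j

-- A subdivision is given by the number  s e  of new internal vertices
-- placed on each edge e (the edge becomes a directed path of length s e + 1).

Subdiv : ℕ → Set
Subdiv r = {x y : EV r} → EE r x y → ℕ

data WV (r : ℕ) (s : Subdiv r) : Set where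
  orig : EV r → WV r s
  sub  : {x y : EV r} (e : EE r x y) → Fin (s e) → WV r s

data WE (r : ℕ) (s : Subdiv r) : WV r s → WV r s → Set where
  direct : {x y : EV r} (e : EE r x y) → s e ≡ 0 → WE r s (orig x) (orig y)
  first  : {x y : EV r} (e : EE r x y) (t : Fin (s e)) → toℕ t ≡ 0 →
           WE r s (orig x) (sub e t)
  step   : {x y : EV r} (e : EE r x y) (t t' : Fin (s e)) → toℕ t' ≡ suc (toℕ t) →
           WE r s (sub e t) (sub e t')
  final  : {x y : EV r} (e : EE r x y) (t : Fin (s e)) → suc (toℕ t) ≡ s e →
           WE r s (sub e t) (orig y)

OnCycle : (r : ℕ) (s : Subdiv r) → WV r s → Fin r → Set
OnCycle r s (orig x) c = vrow x ≡ c
OnCycle r s (sub e t) c = edgeRow e ≡ just c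

OnColumn : (r : ℕ) (s : Subdiv r) → WV r s → ℕ → Set
OnColumn r s (orig x) j = toℕ (vcol x) ≡ j
OnColumn r s (sub e t) j = Σ (Fin (2 * r)) λ c → (edgeCol e ≡ just c) × (toℕ c ≡ j)

OnP11 : (r : ℕ) (s : Subdiv r) → WV r s → Set
OnP11 r s x = OnColumn r s x 0

data IsWalk (r : ℕ) (s : Subdiv r) : List (WV r s) → Set where
  single : (x : WV r s) → IsWalk r s (x ∷ [])
  cons   : (x y : WV r s) (xs : List (WV r s)) → WE r s x y →
           IsWalk r s (y ∷ xs) → IsWalk r s (x ∷ y ∷ xs)

IsPath : (r : ℕ) (s : Subdiv r) → List⁺ (WV r s) → Set
IsPath r s p = IsWalk r s (toList p) × Unique (toList p)

VertexDisjoint : {r : ℕ} {s : Subdiv r} → List⁺ (WV r s) → List⁺ (WV r s) → Set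
VertexDisjoint p q = ∀ x → x ∈ toList p → ¬ (x ∈ toList q)

module Submission where

-- Identify a vertex of the wall with its nested cycle and its position along that cycle.  Since
-- 2k(k + 2) ≤ w, a pigeonhole argument gives a window of 2k consecutive columns containing no
-- source.  A source that can reach a target on its own cycle without crossing the window is
-- routed there along the cycle.  The remaining sources ("movers") and the remaining targets are
-- equally many and are matched monotonically in the order of their cycles.  A mover runs along
-- its cycle to its own column of the window, along that column to the cycle of its target
-- (downwards on even columns, upwards on odd ones, as the wall dictates), and along that cycle
-- to its target on P¹₁.
-- The columns are assigned in the order of the matching, which makes all routes disjoint.

open import Defs
open import Data.Nat using (ℕ; _≤_; _+_; _*_)
open import Data.Fin using (Fin)
open import Data.Product using (_×_; Σ; ∃; ∃-syntax; _,_)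
open import Data.List.NonEmpty using (List⁺; head; last)
open import Relation.Binary.PropositionalEquality using (_≡_; _≢_)

open import Data.Empty using (⊥; ⊥-elim)
open import Data.Fin using (toℕ; fromℕ<; zero; suc)
open import Data.Fin.Properties using (any?; all?; toℕ<n; toℕ-injective; toℕ-fromℕ<; pigeonhole; ¬∀⟶∃¬)
import Data.Fin.Properties as Fin
open import Data.List using (List; []; _∷_; _++_; map; initLast; _∷ʳ′_; _∷ʳ_)
open import Data.List.Membership.Propositional using (_∈_)
open import Data.List.Membership.Propositional.Properties using (∈-map⁻)
open import Data.List.NonEmpty using (_∷_; toList)
open import Data.List.Properties using (map-++; map-cong; map-∘; ++-assoc)
open import Data.List.Relation.Unary.All as All using (All; []; _∷_)
import Data.List.Relation.Unary.All.Properties as All++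
open import Data.List.Relation.Unary.AllPairs using ([]; _∷_)
open import Data.List.Relation.Unary.Unique.Propositional using (Unique)
import Data.List.Relation.Unary.Unique.Propositional.Properties as Uq
open import Data.Nat
open import Data.Nat.DivMod
open import Data.Nat.Properties
open import Data.Nat.Solver using (module +-*-Solver)
open import Data.Product using (proj₁; proj₂)
open import Data.Sum using (_⊎_; inj₁; inj₂; [_,_]′)
open import Function using (_∘_)
open import Relation.Binary.Definitions using (Tri; tri<; tri≈; tri>)
open import Relation.Binary.PropositionalEquality
open import Relation.Nullary
open import Relation.Nullary.Decidable using (_×-dec_; _⊎-dec_; ¬?)
open import Relation.Unary using (Decidable)

count : {P : ℕ → Set} → Decidable P → ℕ → ℕ
count P? zero = 0
count P? (suc n) with P? n
... | yes _ = suc (count P? n)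
... | no _ = count P? n

count-cong : ∀ {P Q : ℕ → Set} (P? : Decidable P) (Q? : Decidable Q) →
  (∀ r → P r → Q r) → (∀ r → Q r → P r) → ∀ n → count P? n ≡ count Q? n
count-cong P? Q? f g zero = refl
count-cong P? Q? f g (suc n) with P? n | Q? n
... | yes _ | yes _ = cong suc (count-cong P? Q? f g n)
... | yes p | no ¬q = contradiction (f n p) ¬q
... | no ¬p | yes q = contradiction (g n q) ¬p
... | no _ | no _ = count-cong P? Q? f g n

count-⊎ : ∀ {P Q R : ℕ → Set} (P? : Decidable P) (Q? : Decidable Q) (R? : Decidable R) →
  (∀ r → P r → Q r ⊎ R r) → (∀ r → Q r → P r) → (∀ r → R r → P r) → (∀ r → Q r → ¬ R r) →
  ∀ n → count P? n ≡ count Q? n + count R? n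
count-⊎ P? Q? R? f g h d zero = refl
count-⊎ P? Q? R? f g h d (suc n) with P? n | Q? n | R? n
... | yes p | yes q | yes r = contradiction r (d n q)
... | yes p | yes q | no _ = cong suc (count-⊎ P? Q? R? f g h d n)
... | yes p | no _ | yes r = trans (cong suc (count-⊎ P? Q? R? f g h d n)) (sym (+-suc _ _))
... | yes p | no ¬q | no ¬r = ⊥-elim ([ ¬q , ¬r ]′ (f n p))
... | no ¬p | yes q | _ = contradiction (g n q) ¬p
... | no ¬p | no _ | yes r = contradiction (h n r) ¬p
... | no _ | no _ | no _ = count-⊎ P? Q? R? f g h d n

count-≟-≤ : ∀ x n → n ≤ x → count (x ≟_) n ≡ 0
count-≟-≤ x zero _ = refl
count-≟-≤ x (suc n) n<x with x ≟ n
... | yes refl = contradiction n<x (<-irrefl refl)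
... | no _ = count-≟-≤ x n (<⇒≤ n<x)

count-≟ : ∀ x n → x < n → count (x ≟_) n ≡ 1
count-≟ x (suc n) x<1+n with x ≟ n
... | yes refl = cong suc (count-≟-≤ x x ≤-refl)
... | no x≢n = count-≟ x n (≤∧≢⇒< (s≤s⁻¹ x<1+n) x≢n)

module _ {P : ℕ → Set} (P? : Decidable P) where

  count-suc : ∀ n → P n → count P? (suc n) ≡ suc (count P? n)
  count-suc n p with P? n
  ... | yes _ = refl
  ... | no ¬p = contradiction p ¬p

  count-≤-suc : ∀ n → count P? n ≤ count P? (suc n)
  count-≤-suc n with P? n
  ... | yes _ = n≤1+n _
  ... | no _ = ≤-refl

  count-mono-≤ : ∀ {m n} → m ≤ n → count P? m ≤ count P? n
  count-mono-≤ {n = zero} z≤n = ≤-refl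
  count-mono-≤ {n = suc n} m≤1+n with m≤n⇒m<n∨m≡n m≤1+n
  ... | inj₁ m<1+n = ≤-trans (count-mono-≤ (s≤s⁻¹ m<1+n)) (count-≤-suc n)
  ... | inj₂ refl = ≤-refl

  count-mono-< : ∀ {m n} → P m → m < n → count P? m < count P? n
  count-mono-< {m} pm m<n = ≤-trans (≤-reflexive (sym (count-suc m pm))) (count-mono-≤ m<n)

  count-surjective : ∀ n m → m < count P? n → Σ ℕ λ r → r < n × P r × count P? r ≡ m
  count-surjective (suc n) m m<c with P? n
  ... | no _ = let (r , r<n , pr , c≡m) = count-surjective n m m<c in r , m≤n⇒m≤1+n r<n , pr , c≡m
  ... | yes pn with m <? count P? n
  ...   | yes m<c′ = let (r , r<n , pr , c≡m) = count-surjective n m m<c′ in r , m≤n⇒m≤1+n r<n , pr , c≡m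
  ...   | no m≮c′ = n , ≤-refl , pn , ≤-antisym (≮⇒≥ m≮c′) (s≤s⁻¹ m<c)

InImage : ∀ {k} → (Fin k → ℕ) → ℕ → Set
InImage {k} f r = Σ (Fin k) λ a → f a ≡ r

inImage? : ∀ {k} (f : Fin k → ℕ) → Decidable (InImage f)
inImage? f r = any? (λ a → f a ≟ r)

count-inImage : ∀ {k} (f : Fin k → ℕ) → (∀ a b → f a ≡ f b → a ≡ b) →
  ∀ n → (∀ a → f a < n) → count (inImage? f) n ≡ k
count-inImage {zero} f inj n bd = count-none n
  where
  count-none : ∀ n → count (inImage? f) n ≡ 0
  count-none zero = refl
  count-none (suc n) with inImage? f n
  ... | yes (() , _)
  ... | no _ = count-none n
count-inImage {suc k} f inj n bd = begin
  count (inImage? f) n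
    ≡⟨ count-⊎ (inImage? f) (f zero ≟_) (inImage? (f ∘ suc))
         (λ { r (zero , e) → inj₁ e ; r (suc a , e) → inj₂ (a , e) })
         (λ r e → zero , e) (λ { r (a , e) → suc a , e })
         (λ { r e (a , e′) → Fin.0≢1+n (inj zero (suc a) (trans e (sym e′))) }) n ⟩
  count (f zero ≟_) n + count (inImage? (f ∘ suc)) n
    ≡⟨ cong₂ _+_ (count-≟ (f zero) n (bd zero))
         (count-inImage (f ∘ suc) (λ a b e → Fin.suc-injective (inj (suc a) (suc b) e)) n (bd ∘ suc)) ⟩
  suc k ∎
  where open ≡-Reasoning

lastOf : ∀ {A : Set} → A → List A → A
lastOf x [] = x
lastOf x (y ∷ ys) = lastOf y ys

lastOf-∷ʳ : ∀ {A : Set} (x : A) ys y → lastOf x (ys ∷ʳ y) ≡ y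
lastOf-∷ʳ x [] y = refl
lastOf-∷ʳ x (z ∷ zs) y = lastOf-∷ʳ z zs y

last≡lastOf : ∀ {A : Set} (x : A) xs → last (x ∷ xs) ≡ lastOf x xs
last≡lastOf x xs with initLast xs
... | [] = refl
... | ys ∷ʳ′ y = sym (lastOf-∷ʳ x ys y)

lastOf-++ : ∀ {A : Set} (x : A) xs y ys → lastOf x (xs ++ y ∷ ys) ≡ lastOf y ys
lastOf-++ x [] y ys = refl
lastOf-++ x (z ∷ zs) y ys = lastOf-++ z zs y ys

lastOf-map : ∀ {A B : Set} (f : A → B) x xs → lastOf (f x) (map f xs) ≡ f (lastOf x xs)
lastOf-map f x [] = refl
lastOf-map f x (y ∷ ys) = lastOf-map f y ys

range : ℕ → ℕ → List ℕ
range a zero = []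
range a (suc n) = a ∷ range (suc a) n

range-bounds : ∀ a n → All (λ t → a ≤ t × t < a + n) (range a n)
range-bounds a zero = []
range-bounds a (suc n) = (≤-refl , subst (a <_) (sym (+-suc a n)) (s≤s (m≤m+n a n))) ∷
  All.map (λ { {t} (a<t , t<) → <⇒≤ a<t , subst (t <_) (sym (+-suc a n)) t< }) (range-bounds (suc a) n)

range-Unique : ∀ a n → Unique (range a n)
range-Unique a zero = []
range-Unique a (suc n) = All.map (λ { (a<t , _) a≡t → <-irrefl a≡t a<t }) (range-bounds (suc a) n) ∷ range-Unique (suc a) n

Unique-++ : ∀ {A : Set} {P Q : A → Set} {xs ys} → Unique xs → Unique ys → All P xs → All Q ys →
            (∀ x → P x → Q x → ⊥) → Unique (xs ++ ys)
Unique-++ ux uy ax ay disjoint = Uq.++⁺ ux uy (λ (x∈xs , x∈ys) → disjoint _ (All.lookup ax x∈xs) (All.lookup ay x∈ys))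

module Wall (w0 : ℕ) (s : Subdiv (suc w0)) where
  W : ℕ
  W = suc w0
  C : ℕ
  C = 2 * W

  Mid-irrelevant : ∀ {I} (m m' : Mid W I) → m ≡ m'
  Mid-irrelevant (a , b) (a' , b') = cong₂ _,_ (<-irrelevant a a') (<-irrelevant b b')

  mid?-yes : ∀ I (m : Mid W I) → mid? W I ≡ yes m
  mid?-yes I m with mid? W I
  ... | yes m' = cong yes (Mid-irrelevant m' m)
  ... | no nm = ⊥-elim (nm m)

  mid?-no : ∀ I (nm : ¬ Mid W I) → mid? W I ≡ no nm
  mid?-no I nm with mid? W I
  ... | yes m = ⊥-elim (nm m)
  ... | no nm' = refl

  nextCol : Fin C → Fin C
  nextCol J with suc (toℕ J) <? C
  ... | yes p = fromℕ< p
  ... | no _ = zero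

  cycleEdge : (I : Fin W) (J : Fin C) → EE W (vout W I J) (vin W I (nextCol J))
  cycleEdge I J with suc (toℕ J) <? C
  ... | yes p = cyc I J (fromℕ< p) (toℕ-fromℕ< p)
  ... | no np = cycwrap I J zero (≤-antisym (toℕ<n J) (≮⇒≥ np)) refl

  -- The segment of cycle I at column J is v^I_J,in, the subdivision vertices of the split edge,
  -- v^I_J,out and the subdivision vertices of the cycle edge leaving it; the nested cycle C_I is
  -- the concatenation of its 2W segments.  segVertex I J o is the o-th vertex of the segment.

  cycleSubs : Fin W → Fin C → ℕ
  cycleSubs I J = s (cycleEdge I J)

  splitSubs : ∀ I J → Mid W I → ℕ
  splitSubs I J m = s (split I J m)

  outIndex′ : ∀ I J → Dec (Mid W I) → ℕ
  outIndex′ I J (yes m) = suc (splitSubs I J m)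
  outIndex′ I J (no _) = 0

  outIndex : Fin W → Fin C → ℕ
  outIndex I J = outIndex′ I J (mid? W I)

  segLength : Fin W → Fin C → ℕ
  segLength I J = suc (outIndex I J + cycleSubs I J)

  -- out-of-range indices get the junk value v^I_J,in
  cycleSubVertex : (I : Fin W) (J : Fin C) → ℕ → WV W s
  cycleSubVertex I J u with u <? cycleSubs I J
  ... | yes p = sub (cycleEdge I J) (fromℕ< p)
  ... | no _ = orig (v I J)

  segVertex⁺ : (I : Fin W) (J : Fin C) → ℕ → Dec (Mid W I) → WV W s
  segVertex⁺ I J o (yes m) with <-cmp o (splitSubs I J m)
  ... | tri< lt _ _ = sub (split I J m) (fromℕ< lt)
  ... | tri≈ _ _ _ = orig (v' I J m)
  ... | tri> _ _ _ = cycleSubVertex I J (o ∸ suc (splitSubs I J m))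
  segVertex⁺ I J o (no _) = cycleSubVertex I J o

  segVertex : Fin W → Fin C → ℕ → WV W s
  segVertex I J zero = orig (v I J)
  segVertex I J (suc o) = segVertex⁺ I J o (mid? W I)

  outIndex-mid : ∀ I J (m : Mid W I) → outIndex I J ≡ suc (splitSubs I J m)
  outIndex-mid I J m = cong (outIndex′ I J) (mid?-yes I m)

  outIndex-¬mid : ∀ I J (nm : ¬ Mid W I) → outIndex I J ≡ 0
  outIndex-¬mid I J nm = cong (outIndex′ I J) (mid?-no I nm)

  cycleSubVertex-def : ∀ I J u (lt : u < cycleSubs I J) → cycleSubVertex I J u ≡ sub (cycleEdge I J) (fromℕ< lt)
  cycleSubVertex-def I J u lt with u <? cycleSubs I J
  ... | yes p = cong (λ z → sub (cycleEdge I J) (fromℕ< z)) (<-irrelevant p lt)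
  ... | no np = ⊥-elim (np lt)

  segVertex⁺-mid-cycle : ∀ I J m u → segVertex⁺ I J (suc (splitSubs I J m) + u) (yes m) ≡ cycleSubVertex I J u
  segVertex⁺-mid-cycle I J m u with <-cmp (suc (splitSubs I J m) + u) (splitSubs I J m)
  ... | tri< a _ _ = ⊥-elim (<-irrefl refl (<-trans (s≤s (m≤m+n (splitSubs I J m) u)) a))
  ... | tri≈ _ b _ = ⊥-elim (<-irrefl (sym b) (s≤s (m≤m+n (splitSubs I J m) u)))
  ... | tri> _ _ c = cong (cycleSubVertex I J) (m+n∸m≡n (suc (splitSubs I J m)) u)

  segVertex⁺-mid-out : ∀ I J m → segVertex⁺ I J (splitSubs I J m) (yes m) ≡ orig (v' I J m)
  segVertex⁺-mid-out I J m with <-cmp (splitSubs I J m) (splitSubs I J m)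
  ... | tri< a _ _ = ⊥-elim (<-irrefl refl a)
  ... | tri≈ _ _ _ = refl
  ... | tri> _ _ c = ⊥-elim (<-irrefl refl c)

  segVertex⁺-mid-split : ∀ I J m o (lt : o < splitSubs I J m) → segVertex⁺ I J o (yes m) ≡ sub (split I J m) (fromℕ< lt)
  segVertex⁺-mid-split I J m o lt with <-cmp o (splitSubs I J m)
  ... | tri< a _ _ = cong (λ z → sub (split I J m) (fromℕ< z)) (<-irrelevant a lt)
  ... | tri≈ _ b _ = ⊥-elim (<-irrefl b lt)
  ... | tri> _ _ c = ⊥-elim (<-asym lt c)

  segVertex-out-mid : ∀ I J m → segVertex I J (suc (splitSubs I J m)) ≡ orig (v' I J m)
  segVertex-out-mid I J m = trans (cong (segVertex⁺ I J (splitSubs I J m)) (mid?-yes I m)) (segVertex⁺-mid-out I J m)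

  segVertex-split : ∀ I J m o (lt : o < splitSubs I J m) → segVertex I J (suc o) ≡ sub (split I J m) (fromℕ< lt)
  segVertex-split I J m o lt = trans (cong (segVertex⁺ I J o) (mid?-yes I m)) (segVertex⁺-mid-split I J m o lt)

  segVertex-outIndex : ∀ I J → segVertex I J (outIndex I J) ≡ orig (vout W I J)
  segVertex-outIndex I J with mid? W I
  ... | yes m = segVertex-out-mid I J m
  ... | no nm = refl

  segVertex-cycle : ∀ I J u → segVertex I J (suc (outIndex I J + u)) ≡ cycleSubVertex I J u
  segVertex-cycle I J u = byMid (mid? W I)
    where
    byMid : ∀ d → segVertex⁺ I J (outIndex′ I J d + u) d ≡ cycleSubVertex I J u
    byMid (yes m) = segVertex⁺-mid-cycle I J m u
    byMid (no _) = refl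

  edge-out→cycleSub : ∀ I J → 0 < cycleSubs I J → WE W s (segVertex I J (outIndex I J + 0)) (segVertex I J (suc (outIndex I J + 0)))
  edge-out→cycleSub I J lt = subst₂ (WE W s) (sym (trans (cong (segVertex I J) (+-identityʳ (outIndex I J))) (segVertex-outIndex I J))) (sym (trans (segVertex-cycle I J 0) (cycleSubVertex-def I J 0 lt)))
                   (first (cycleEdge I J) (fromℕ< lt) (toℕ-fromℕ< lt))

  edge-cycleSub : ∀ I J u → suc u < cycleSubs I J → WE W s (segVertex I J (suc (outIndex I J + u))) (segVertex I J (suc (outIndex I J + suc u)))
  edge-cycleSub I J u lt = subst₂ (WE W s) (sym (trans (segVertex-cycle I J u) (cycleSubVertex-def I J u lt1))) (sym (trans (segVertex-cycle I J (suc u)) (cycleSubVertex-def I J (suc u) lt)))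
                   (step (cycleEdge I J) (fromℕ< lt1) (fromℕ< lt) (trans (toℕ-fromℕ< lt) (cong suc (sym (toℕ-fromℕ< lt1)))))
    where lt1 = <-trans (n<1+n u) lt

  edge-inBlock : ∀ I J m o → o < suc (splitSubs I J m) → WE W s (segVertex I J o) (segVertex I J (suc o))
  edge-inBlock I J m zero _ with 0 <? splitSubs I J m
  ... | yes lt = subst (WE W s _) (sym (segVertex-split I J m 0 lt)) (first (split I J m) (fromℕ< lt) (toℕ-fromℕ< lt))
  ... | no nlt = subst (WE W s _) (sym (trans (cong (λ z → segVertex I J (suc z)) (sym eq0)) (segVertex-out-mid I J m))) (direct (split I J m) eq0)
    where eq0 = n≤0⇒n≡0 (≮⇒≥ nlt)
  edge-inBlock I J m (suc o) (s≤s lt1) with suc o <? splitSubs I J m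
  ... | yes lt2 = subst₂ (WE W s) (sym (segVertex-split I J m o lt1)) (sym (segVertex-split I J m (suc o) lt2))
                  (step (split I J m) (fromℕ< lt1) (fromℕ< lt2) (trans (toℕ-fromℕ< lt2) (cong suc (sym (toℕ-fromℕ< lt1)))))
  ... | no nlt2 = subst₂ (WE W s) (sym (segVertex-split I J m o lt1)) (sym (trans (cong (λ z → segVertex I J (suc z)) eq1) (segVertex-out-mid I J m)))
                  (final (split I J m) (fromℕ< lt1) (trans (cong suc (toℕ-fromℕ< lt1)) eq1))
    where eq1 = ≤-antisym lt1 (≮⇒≥ nlt2)

  edge-inSegment : ∀ I J o → suc o < segLength I J → WE W s (segVertex I J o) (segVertex I J (suc o))
  edge-inSegment I J o lt with o <? outIndex I J
  ... | yes lo = beforeOut (mid? W I)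
    where
    beforeOut : Dec (Mid W I) → WE W s (segVertex I J o) (segVertex I J (suc o))
    beforeOut (yes m) = edge-inBlock I J m o (subst (o <_) (outIndex-mid I J m) lo)
    beforeOut (no nm) = ⊥-elim (n≮0 (subst (o <_) (outIndex-¬mid I J nm) lo))
  ... | no nlo = afterOut (o ∸ outIndex I J) (sym (m+[n∸m]≡n (≮⇒≥ nlo)))
    where
    afterOut : ∀ u → o ≡ outIndex I J + u → WE W s (segVertex I J o) (segVertex I J (suc o))
    afterOut zero eq rewrite eq = edge-out→cycleSub I J (+-cancelˡ-< (outIndex I J) 0 (cycleSubs I J) (s≤s⁻¹ lt))
    afterOut (suc u) eq rewrite eq = subst (λ z → WE W s (segVertex I J z) (segVertex I J (suc (outIndex I J + suc u)))) (sym (+-suc (outIndex I J) u))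
                                   (edge-cycleSub I J u (+-cancelˡ-< (outIndex I J) (suc u) (cycleSubs I J) (s≤s⁻¹ lt)))

  edge-toNextSegment : ∀ I J → WE W s (segVertex I J (outIndex I J + cycleSubs I J)) (segVertex I (nextCol J) 0)
  edge-toNextSegment I J = bySubdivisions (cycleSubs I J) refl
    where
    bySubdivisions : ∀ n → cycleSubs I J ≡ n → WE W s (segVertex I J (outIndex I J + cycleSubs I J)) (segVertex I (nextCol J) 0)
    bySubdivisions zero eq = subst (λ z → WE W s (segVertex I J z) (orig (v I (nextCol J)))) (sym (trans (cong (outIndex I J +_) eq) (+-identityʳ _)))
                   (subst (λ z → WE W s z (orig (v I (nextCol J)))) (sym (segVertex-outIndex I J)) (direct (cycleEdge I J) eq))
    bySubdivisions (suc u) eq = subst (λ z → WE W s (segVertex I J z) (orig (v I (nextCol J)))) (sym (trans (cong (outIndex I J +_) eq) (+-suc _ u)))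
                   (subst (λ z → WE W s z (orig (v I (nextCol J)))) (sym (trans (segVertex-cycle I J u) (cycleSubVertex-def I J u lt)))
                     (final (cycleEdge I J) (fromℕ< lt) (trans (cong suc (toℕ-fromℕ< lt)) (sym eq))))
      where lt : u < cycleSubs I J
            lt = subst (u <_) (sym eq) (n<1+n u)

  -- rowPt i j o is the o-th vertex of the segment of cycle i at column j, rungPt i j t the t-th
  -- subdivision vertex of the vertical edge of column j between the cycles i and i + 1.
  data Point : Set where
    rowPt : ℕ → ℕ → ℕ → Point
    rungPt : ℕ → ℕ → ℕ → Point

  rowFin : ℕ → Fin W
  rowFin i = i mod W

  colFin : ℕ → Fin C
  colFin j = j mod C

  toℕ-rowFin : ∀ {i} → i < W → toℕ (rowFin i) ≡ i
  toℕ-rowFin {i} lt = trans (toℕ-fromℕ< (m%n<n i W)) (m<n⇒m%n≡m lt)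

  toℕ-colFin : ∀ {j} → j < C → toℕ (colFin j) ≡ j
  toℕ-colFin {j} lt = trans (toℕ-fromℕ< (m%n<n j C)) (m<n⇒m%n≡m lt)

  rowFin-toℕ : ∀ (I : Fin W) → rowFin (toℕ I) ≡ I
  rowFin-toℕ I = toℕ-injective (toℕ-rowFin (toℕ<n I))

  colFin-toℕ : ∀ (J : Fin C) → colFin (toℕ J) ≡ J
  colFin-toℕ J = toℕ-injective (toℕ-colFin (toℕ<n J))

  nextColℕ : ℕ → ℕ
  nextColℕ j with suc j <? C
  ... | yes _ = suc j
  ... | no _ = 0

  colFin-nextColℕ : ∀ j → j < C → colFin (nextColℕ j) ≡ nextCol (colFin j)
  colFin-nextColℕ j lt with suc j <? C | suc (toℕ (colFin j)) <? C
  ... | yes p | yes p' = toℕ-injective (trans (toℕ-colFin p) (sym (trans (toℕ-fromℕ< p') (cong suc (toℕ-colFin lt)))))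
  ... | yes p | no np' = ⊥-elim (np' (subst (λ z → suc z < C) (sym (toℕ-colFin lt)) p))
  ... | no np | yes p' = ⊥-elim (np (subst (λ z → suc z < C) (toℕ-colFin lt) p'))
  ... | no np | no np' = toℕ-injective (toℕ-colFin {0} (s≤s z≤n))

  outIndexℕ : ℕ → ℕ → ℕ
  outIndexℕ i j = outIndex (rowFin i) (colFin j)

  segLengthℕ : ℕ → ℕ → ℕ
  segLengthℕ i j = segLength (rowFin i) (colFin j)

  edgeSubVertex : ∀ {x y} (e : EE W x y) → ℕ → WV W s
  edgeSubVertex e t with t <? s e
  ... | yes p = sub e (fromℕ< p)
  ... | no _ = orig (v zero zero)

  toℕ-rowFin-suc : ∀ {i} → suc i < W → toℕ (rowFin (suc i)) ≡ suc (toℕ (rowFin i))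
  toℕ-rowFin-suc {i} p = trans (toℕ-rowFin p) (cong suc (sym (toℕ-rowFin (<-trans (n<1+n i) p))))

  colFin-even : ∀ {j} → j < C → j % 2 ≡ 0 → toℕ (colFin j) % 2 ≡ 0
  colFin-even q e = trans (cong (_% 2) (toℕ-colFin q)) e

  colFin-odd : ∀ {j} → j < C → ¬ (j % 2 ≡ 0) → toℕ (colFin j) % 2 ≡ 1
  colFin-odd {j} q ne = trans (cong (_% 2) (toℕ-colFin q)) (<2∧≢0⇒≡1 (j % 2) (m%n<n j 2) ne)
    where
    <2∧≢0⇒≡1 : ∀ x → x < 2 → ¬ x ≡ 0 → x ≡ 1
    <2∧≢0⇒≡1 zero _ x≢0 = ⊥-elim (x≢0 refl)
    <2∧≢0⇒≡1 (suc zero) _ _ = refl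
    <2∧≢0⇒≡1 (suc (suc x)) (s≤s (s≤s ())) _

  rungLength : ℕ → ℕ → ℕ
  rungLength i j with suc i <? W | j <? C | j % 2 ≟ 0
  ... | yes p | yes q | yes e = s (down (rowFin i) (rowFin (suc i)) (colFin j) (toℕ-rowFin-suc p) (colFin-even q e))
  ... | yes p | yes q | no e = s (up (rowFin i) (rowFin (suc i)) (colFin j) (toℕ-rowFin-suc p) (colFin-odd q e))
  ... | _ | _ | _ = 0

  rungVertex : ℕ → ℕ → ℕ → WV W s
  rungVertex i j t with suc i <? W | j <? C | j % 2 ≟ 0
  ... | yes p | yes q | yes e = edgeSubVertex (down (rowFin i) (rowFin (suc i)) (colFin j) (toℕ-rowFin-suc p) (colFin-even q e)) t
  ... | yes p | yes q | no e = edgeSubVertex (up (rowFin i) (rowFin (suc i)) (colFin j) (toℕ-rowFin-suc p) (colFin-odd q e)) t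
  ... | _ | _ | _ = orig (v zero zero)

  -- a genuine vertex only on Valid points, junk elsewhere
  vertexAt : Point → WV W s
  vertexAt (rowPt i j o) = segVertex (rowFin i) (colFin j) o
  vertexAt (rungPt i j t) = rungVertex i j t

  Valid : Point → Set
  Valid (rowPt i j o) = i < W × j < C × o < segLengthℕ i j
  Valid (rungPt i j t) = j < C × t < rungLength i j

  next : Point → Point
  next (rowPt i j o) with suc o <? segLengthℕ i j
  ... | yes _ = rowPt i j (suc o)
  ... | no _ = rowPt i (nextColℕ j) 0
  next p = p


  Walk : List (WV W s) → Set
  Walk = IsWalk W s

  Walk-++ : ∀ x xs ys → Walk (x ∷ xs) → Walk (lastOf x xs ∷ ys) → Walk (x ∷ xs ++ ys)
  Walk-++ x [] ys w1 w2 = w2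
  Walk-++ x (y ∷ xs) ys (cons .x .y .xs e w1) w2 = cons x y (xs ++ ys) e (Walk-++ y xs ys w1 w2)

  Walk-++-vertexAt : ∀ x xs ys → Walk (map vertexAt (x ∷ xs)) → Walk (map vertexAt (lastOf x xs ∷ ys)) → Walk (map vertexAt (x ∷ xs ++ ys))
  Walk-++-vertexAt x xs ys w1 w2 = subst Walk (cong (vertexAt x ∷_) (sym (map-++ vertexAt xs ys)))
    (Walk-++ (vertexAt x) (map vertexAt xs) (map vertexAt ys) w1 (subst (λ z → Walk (z ∷ map vertexAt ys)) (sym (lastOf-map vertexAt x xs)) w2))

  edgeSubVertex-def : ∀ {x y} (e : EE W x y) t (lt : t < s e) → edgeSubVertex e t ≡ sub e (fromℕ< lt)
  edgeSubVertex-def e t lt with t <? s e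
  ... | yes p = cong (λ z → sub e (fromℕ< z)) (<-irrelevant p lt)
  ... | no np = ⊥-elim (np lt)

  Walk-edge : ∀ {x y} (e : EE W x y) ys → Walk (orig y ∷ ys) →
              Walk (orig x ∷ map (edgeSubVertex e) (range 0 (s e)) ++ orig y ∷ ys)
  Walk-edge {x} {y} e ys w = fromOrigin (s e) refl
    where
    fromSub : ∀ k n → k + suc n ≡ s e → Walk (map (edgeSubVertex e) (range k (suc n)) ++ orig y ∷ ys)
    fromSub k zero k+1≡ = cons _ _ _ (subst (λ z → WE W s z (orig y)) (sym (edgeSubVertex-def e k k<))
                            (final e (fromℕ< k<) (trans (cong suc (toℕ-fromℕ< k<)) (trans (+-comm 1 k) k+1≡)))) w
      where k< = subst (k <_) k+1≡ (m<m+n k (s≤s z≤n))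
    fromSub k (suc n) k+2+n≡ = cons _ _ _ (subst₂ (WE W s) (sym (edgeSubVertex-def e k k<)) (sym (edgeSubVertex-def e (suc k) k+1<))
                                 (step e (fromℕ< k<) (fromℕ< k+1<) (trans (toℕ-fromℕ< k+1<) (cong suc (sym (toℕ-fromℕ< k<))))))
                               (fromSub (suc k) n k+1+1+n≡)
      where
      k+1+1+n≡ = trans (sym (+-suc k (suc n))) k+2+n≡
      k+1< = subst (suc k <_) k+1+1+n≡ (m<m+n (suc k) (s≤s z≤n))
      k< = <-trans (n<1+n k) k+1<
    WalkVia : ℕ → Set
    WalkVia n = Walk (orig x ∷ map (edgeSubVertex e) (range 0 n) ++ orig y ∷ ys)
    fromOrigin : ∀ n → s e ≡ n → WalkVia (s e)
    fromOrigin zero s≡0 = subst WalkVia (sym s≡0) (cons _ _ _ (direct e s≡0) w)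
    fromOrigin (suc n) s≡ = subst WalkVia (sym s≡)
      (cons _ _ _ (subst (WE W s (orig x)) (sym (edgeSubVertex-def e 0 0<)) (first e (fromℕ< 0<) (toℕ-fromℕ< 0<))) (fromSub 0 n (sym s≡)))
      where 0< = subst (0 <_) (sym s≡) (s≤s z≤n)

  downEdge : ∀ i j → suc i < W → j < C → j % 2 ≡ 0 →
        Σ (EE W (vout W (rowFin i) (colFin j)) (vin W (rowFin (suc i)) (colFin j))) λ e → (rungLength i j ≡ s e) × (∀ t → rungVertex i j t ≡ edgeSubVertex e t)
  downEdge i j p q e with suc i <? W | j <? C | j % 2 ≟ 0
  ... | yes p' | yes q' | yes e' = down (rowFin i) (rowFin (suc i)) (colFin j) (toℕ-rowFin-suc p') (colFin-even q' e') , refl , λ t → refl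
  ... | yes p' | yes q' | no ne = ⊥-elim (ne e)
  ... | yes p' | no nq | _ = ⊥-elim (nq q)
  ... | no np | _ | _ = ⊥-elim (np p)

  upEdge : ∀ i j → suc i < W → j < C → ¬ (j % 2 ≡ 0) →
        Σ (EE W (vout W (rowFin (suc i)) (colFin j)) (vin W (rowFin i) (colFin j))) λ e → (rungLength i j ≡ s e) × (∀ t → rungVertex i j t ≡ edgeSubVertex e t)
  upEdge i j p q e with suc i <? W | j <? C | j % 2 ≟ 0
  ... | yes p' | yes q' | yes e' = ⊥-elim (e e')
  ... | yes p' | yes q' | no ne = up (rowFin i) (rowFin (suc i)) (colFin j) (toℕ-rowFin-suc p') (colFin-odd q' ne) , refl , λ t → refl
  ... | yes p' | no nq | _ = ⊥-elim (nq q)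
  ... | no np | _ | _ = ⊥-elim (np p)

  coords : WV W s → Point
  coords (orig (v i j)) = rowPt (toℕ i) (toℕ j) 0
  coords (orig (v' i j m)) = rowPt (toℕ i) (toℕ j) (suc (splitSubs i j m))
  coords (sub (cyc i j j' p) t) = rowPt (toℕ i) (toℕ j) (suc (outIndex i j + toℕ t))
  coords (sub (cycwrap i j j' p q) t) = rowPt (toℕ i) (toℕ j) (suc (outIndex i j + toℕ t))
  coords (sub (split i j m) t) = rowPt (toℕ i) (toℕ j) (suc (toℕ t))
  coords (sub (down i i' j p q) t) = rungPt (toℕ i) (toℕ j) (toℕ t)
  coords (sub (up i i' j p q) t) = rungPt (toℕ i) (toℕ j) (toℕ t)

  coords-cycleEdge : ∀ I J (t : Fin (cycleSubs I J)) → coords (sub (cycleEdge I J) t) ≡ rowPt (toℕ I) (toℕ J) (suc (outIndex I J + toℕ t))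
  coords-cycleEdge I J t with suc (toℕ J) <? C
  ... | yes p = refl
  ... | no np = refl

  coords-cycleSubVertex : ∀ I J u → u < cycleSubs I J → coords (cycleSubVertex I J u) ≡ rowPt (toℕ I) (toℕ J) (suc (outIndex I J + u))
  coords-cycleSubVertex I J u lt with u <? cycleSubs I J
  ... | yes p = trans (coords-cycleEdge I J (fromℕ< p)) (cong (λ z → rowPt (toℕ I) (toℕ J) (suc (outIndex I J + z))) (toℕ-fromℕ< p))
  ... | no np = ⊥-elim (np lt)

  coords-segVertex : ∀ I J o → o < segLength I J → coords (segVertex I J o) ≡ rowPt (toℕ I) (toℕ J) o
  coords-segVertex I J zero _ = refl
  coords-segVertex I J (suc o) lt = byMid (mid? W I) lt
    where
    byMid : ∀ d → suc o < suc (outIndex′ I J d + cycleSubs I J) → coords (segVertex⁺ I J o d) ≡ rowPt (toℕ I) (toℕ J) (suc o)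
    byMid (yes m) lt' with <-cmp o (splitSubs I J m)
    ... | tri< a _ _ = cong (λ z → rowPt (toℕ I) (toℕ J) (suc z)) (toℕ-fromℕ< a)
    ... | tri≈ _ b _ = cong (λ z → rowPt (toℕ I) (toℕ J) (suc z)) (sym b)
    ... | tri> _ _ c = trans (coords-cycleSubVertex I J (o ∸ suc (splitSubs I J m)) upCol-mono)
                        (cong (λ z → rowPt (toℕ I) (toℕ J) (suc z)) (trans (cong (_+ (o ∸ suc (splitSubs I J m))) (outIndex-mid I J m)) (m+[n∸m]≡n c)))
      where upCol-mono : o ∸ suc (splitSubs I J m) < cycleSubs I J
            upCol-mono = +-cancelˡ-< (suc (splitSubs I J m)) _ _ (subst (_< suc (splitSubs I J m) + cycleSubs I J) (sym (m+[n∸m]≡n c)) (s≤s⁻¹ lt'))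
    byMid (no nm) lt' = trans (coords-cycleSubVertex I J o (s≤s⁻¹ lt')) (cong (λ z → rowPt (toℕ I) (toℕ J) (suc (z + o))) (outIndex-¬mid I J nm))

  coords-vertexAt-rowPt : ∀ i j o → Valid (rowPt i j o) → coords (vertexAt (rowPt i j o)) ≡ rowPt i j o
  coords-vertexAt-rowPt i j o (iw , jc , ol) = trans (coords-segVertex (rowFin i) (colFin j) o ol) (cong₂ (λ a b → rowPt a b o) (toℕ-rowFin iw) (toℕ-colFin jc))

  coords-edgeSubVertex : ∀ {x y} (e : EE W x y) t (lt : t < s e) → coords (edgeSubVertex e t) ≡ coords (sub e (fromℕ< lt))
  coords-edgeSubVertex e t lt = cong coords (edgeSubVertex-def e t lt)

  rungPt-cong : ∀ {i i′ j j′ t t′} → i ≡ i′ → j ≡ j′ → t ≡ t′ → rungPt i j t ≡ rungPt i′ j′ t′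
  rungPt-cong refl refl refl = refl

  coords-vertexAt-rungPt : ∀ i j t → Valid (rungPt i j t) → coords (vertexAt (rungPt i j t)) ≡ rungPt i j t
  coords-vertexAt-rungPt i j t (jc , tl) with suc i <? W | j <? C | j % 2 ≟ 0
  ... | yes p | yes q | yes e = trans (coords-edgeSubVertex _ t tl) (rungPt-cong (toℕ-rowFin (<-trans (n<1+n i) p)) (toℕ-colFin q) (toℕ-fromℕ< tl))
  ... | yes p | yes q | no e = trans (coords-edgeSubVertex _ t tl) (rungPt-cong (toℕ-rowFin (<-trans (n<1+n i) p)) (toℕ-colFin q) (toℕ-fromℕ< tl))
  ... | yes p | no q | _ = ⊥-elim (q jc)
  ... | no p | _ | _ = ⊥-elim (n≮0 tl)

  coords-vertexAt : ∀ p → Valid p → coords (vertexAt p) ≡ p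
  coords-vertexAt (rowPt i j o) = coords-vertexAt-rowPt i j o
  coords-vertexAt (rungPt i j t) = coords-vertexAt-rungPt i j t

  Edge : Set
  Edge = Σ (EV W) λ x → Σ (EV W) λ y → EE W x y

  edgeSubs : Edge → ℕ
  edgeSubs (_ , _ , e) = s e

  edgeSub : (E : Edge) → Fin (edgeSubs E) → WV W s
  edgeSub (_ , _ , e) t = sub e t

  edgeSub-transport : ∀ {E E' : Edge} → E ≡ E' → (t : Fin (edgeSubs E')) → Σ (Fin (edgeSubs E)) λ t' → (toℕ t' ≡ toℕ t) × (edgeSub E t' ≡ edgeSub E' t)
  edgeSub-transport refl t = t , refl , refl

  cycleEdge≡cyc : ∀ I J j' p → _≡_ {A = Edge} (_ , _ , cycleEdge I J) (_ , _ , cyc I J j' p)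
  cycleEdge≡cyc I J j' p with suc (toℕ J) <? C
  ... | no nq = ⊥-elim (nq (subst (_< C) p (toℕ<n j')))
  ... | yes q with toℕ-injective {i = j'} {j = fromℕ< q} (trans p (sym (toℕ-fromℕ< q)))
  ...   | refl with ≡-irrelevant p (toℕ-fromℕ< q)
  ...     | refl = refl

  cycleEdge≡cycwrap : ∀ I J j' p r → _≡_ {A = Edge} (_ , _ , cycleEdge I J) (_ , _ , cycwrap I J j' p r)
  cycleEdge≡cycwrap I J j' p r with suc (toℕ J) <? C
  ... | yes q = ⊥-elim (<-irrefl p q)
  ... | no nq with toℕ-injective {i = j'} {j = zero} r
  ...   | refl with ≡-irrelevant p (≤-antisym (toℕ<n J) (≮⇒≥ nq)) | ≡-irrelevant r refl
  ...     | refl | refl = refl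

  segVertex-cycleSub : ∀ I J (t' : Fin (cycleSubs I J)) → segVertex I J (suc (outIndex I J + toℕ t')) ≡ sub (cycleEdge I J) t'
  segVertex-cycleSub I J t' = trans (segVertex-cycle I J (toℕ t')) (trans (cycleSubVertex-def I J (toℕ t') (toℕ<n t'))
                      (cong (sub (cycleEdge I J)) (toℕ-injective (toℕ-fromℕ< (toℕ<n t')))))

  OnCycle⇒coords : ∀ x I → OnCycle W s x I → Σ (Fin C) λ J → Σ ℕ λ o → (coords x ≡ rowPt (toℕ I) (toℕ J) o) × (o < segLength I J) × (segVertex I J o ≡ x)
  OnCycle⇒coords (orig (v i j)) .i refl = j , 0 , refl , s≤s z≤n , refl
  OnCycle⇒coords (orig (v' i j m)) .i refl = j , suc (splitSubs i j m) , refl ,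
     s≤s (subst (_≤ outIndex i j + cycleSubs i j) (outIndex-mid i j m) (m≤m+n _ _)) , segVertex-out-mid i j m
  OnCycle⇒coords (sub (split i j m) t) .i refl = j , suc (toℕ t) , refl ,
     s≤s (≤-trans (toℕ<n t) (≤-trans (n≤1+n _) (subst (_≤ outIndex i j + cycleSubs i j) (outIndex-mid i j m) (m≤m+n _ _)))) ,
     trans (segVertex-split i j m (toℕ t) (toℕ<n t)) (cong (sub (split i j m)) (toℕ-injective (toℕ-fromℕ< (toℕ<n t))))
  OnCycle⇒coords (sub (cyc i j j' p) t) .i refl with edgeSub-transport (cycleEdge≡cyc i j j' p) t
  ... | (t' , teq , seq) = j , suc (outIndex i j + toℕ t) , refl ,
     s≤s (+-monoʳ-< (outIndex i j) (subst (_< cycleSubs i j) teq (toℕ<n t'))) ,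
     trans (cong (λ z → segVertex i j (suc (outIndex i j + z))) (sym teq)) (trans (segVertex-cycleSub i j t') seq)
  OnCycle⇒coords (sub (cycwrap i j j' p r) t) .i refl with edgeSub-transport (cycleEdge≡cycwrap i j j' p r) t
  ... | (t' , teq , seq) = j , suc (outIndex i j + toℕ t) , refl ,
     s≤s (+-monoʳ-< (outIndex i j) (subst (_< cycleSubs i j) teq (toℕ<n t'))) ,
     trans (cong (λ z → segVertex i j (suc (outIndex i j + z))) (sym teq)) (trans (segVertex-cycleSub i j t') seq)
  OnCycle⇒coords (sub (down i i' j p q) t) I ()
  OnCycle⇒coords (sub (up i i' j p q) t) I ()

  -- Positions along a nested cycle

  segStart : ℕ → ℕ → ℕ
  segStart i zero = 0
  segStart i (suc j) = segStart i j + segLengthℕ i j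

  rowLength : ℕ → ℕ
  rowLength i = segStart i C

  position : Point → ℕ
  position (rowPt i j o) = segStart i j + o
  position (rungPt _ _ _) = 0

  OnRow : ℕ → Point → Set
  OnRow i (rowPt i' j o) = i' ≡ i × Valid (rowPt i' j o)
  OnRow i (rungPt _ _ _) = ⊥

  segStart-mono : ∀ i {j j′} → j ≤ j′ → segStart i j ≤ segStart i j′
  segStart-mono i {j′ = zero} z≤n = ≤-refl
  segStart-mono i {j′ = suc j′} j≤1+j′ with m≤n⇒m<n∨m≡n j≤1+j′
  ... | inj₁ j<1+j′ = ≤-trans (segStart-mono i (s≤s⁻¹ j<1+j′)) (m≤m+n _ _)
  ... | inj₂ refl = ≤-refl

  position-bounds : ∀ i j o → o < segLengthℕ i j → segStart i j ≤ segStart i j + o × segStart i j + o < segStart i (suc j)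
  position-bounds i j o ol = m≤m+n _ _ , +-monoʳ-< (segStart i j) ol

  position-col : ∀ i j j' o → o < segLengthℕ i j → segStart i j' ≤ segStart i j + o → j' ≤ j
  position-col i j j' o ol le with j' ≤? j
  ... | yes p = p
  ... | no np = ⊥-elim (<-irrefl refl (<-≤-trans (proj₂ (position-bounds i j o ol)) (≤-trans (segStart-mono i (≰⇒> np)) le)))

  position-injective : ∀ i j o j' o' → o < segLengthℕ i j → o' < segLengthℕ i j' → segStart i j + o ≡ segStart i j' + o' → (j ≡ j') × (o ≡ o')
  position-injective i j o j' o' ol ol' eq = jeq , +-cancelˡ-≡ (segStart i j) o o' (trans eq (cong (λ z → segStart i z + o') (sym jeq)))
    where jeq = ≤-antisym (position-col i j' j o' ol' (subst (segStart i j ≤_) eq (m≤m+n _ _)))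
                          (position-col i j j' o ol (subst (segStart i j' ≤_) (sym eq) (m≤m+n _ _)))

  position<rowLength : ∀ i j o → j < C → o < segLengthℕ i j → segStart i j + o < rowLength i
  position<rowLength i j o jc ol = <-≤-trans (proj₂ (position-bounds i j o ol)) (segStart-mono i jc)

  nextColℕ<C : ∀ j → nextColℕ j < C
  nextColℕ<C j with suc j <? C
  ... | yes p = p
  ... | no _ = s≤s z≤n

  next-OnRow : ∀ i p → OnRow i p → OnRow i (next p)
  next-OnRow i (rowPt i′ j o) (i′≡i , i′<W , j<C , o<len) with suc o <? segLengthℕ i′ j
  ... | yes o+1<len = i′≡i , i′<W , j<C , o+1<len
  ... | no _ = i′≡i , i′<W , nextColℕ<C j , s≤s z≤n

  nextColℕ-suc : ∀ j → suc j < C → nextColℕ j ≡ suc j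
  nextColℕ-suc j lt with suc j <? C
  ... | yes _ = refl
  ... | no n = ⊥-elim (n lt)

  nextColℕ-last : ∀ j → suc j ≡ C → nextColℕ j ≡ 0
  nextColℕ-last j eq with suc j <? C
  ... | yes p = ⊥-elim (<-irrefl eq p)
  ... | no n = refl

  position-next : ∀ i p → OnRow i p → suc (position p) < rowLength i → position (next p) ≡ suc (position p)
  position-next i (rowPt i' j o) (refl , iw , jc , ol) lt with suc o <? segLengthℕ i' j
  ... | yes _ = +-suc (segStart i' j) o
  ... | no nlt = byLastCol (suc j <? C)
    where
    eq1 = ≤-antisym ol (≮⇒≥ nlt)
    e2 : suc (segStart i' j + o) ≡ segStart i' (suc j)
    e2 = trans (sym (+-suc (segStart i' j) o)) (cong (segStart i' j +_) eq1)
    byLastCol : Dec (suc j < C) → segStart i' (nextColℕ j) + 0 ≡ suc (segStart i' j + o)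
    byLastCol (yes q) = trans (+-identityʳ _) (trans (cong (segStart i') (nextColℕ-suc j q)) (sym e2))
    byLastCol (no nq) = ⊥-elim (<-irrefl (trans e2 (cong (segStart i') (≤-antisym jc (≮⇒≥ nq)))) lt)

  next-edge : ∀ i p → OnRow i p → WE W s (vertexAt p) (vertexAt (next p))
  next-edge _ (rowPt i j o) (_ , _ , j<C , o<len) with suc o <? segLengthℕ i j
  ... | yes o+1<len = edge-inSegment (rowFin i) (colFin j) o o+1<len
  ... | no o+1≮len = subst₂ (WE W s) (cong (segVertex (rowFin i) (colFin j)) (sym o≡last))
                      (cong (λ z → orig (v (rowFin i) z)) (sym (colFin-nextColℕ j j<C)))
                      (edge-toNextSegment (rowFin i) (colFin j))
    where
    o≡last : o ≡ outIndex (rowFin i) (colFin j) + cycleSubs (rowFin i) (colFin j)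
    o≡last = suc-injective (≤-antisym o<len (≮⇒≥ o+1≮len))

  steps : Point → ℕ → List Point
  steps p zero = []
  steps p (suc n) = next p ∷ steps (next p) n

  OnRow⇒Valid : ∀ i p → OnRow i p → Valid p
  OnRow⇒Valid i (rowPt _ j o) (_ , valid) = valid

  OnRow⇒<W : ∀ i p → OnRow i p → i < W
  OnRow⇒<W i (rowPt .i j o) (refl , iw , _) = iw

  OnRow⇒position<rowLength : ∀ i p → OnRow i p → position p < rowLength i
  OnRow⇒position<rowLength i (rowPt .i j o) (refl , iw , jc , ol) = position<rowLength i j o jc ol

  OnRow-position-injective : ∀ i p q → OnRow i p → OnRow i q → position p ≡ position q → p ≡ q
  OnRow-position-injective i (rowPt .i j o) (rowPt .i j′ o′) (refl , _ , _ , ol) (refl , _ , _ , ol′) eq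
    with position-injective i j o j′ o′ ol ol′ eq
  ... | refl , refl = refl

  OnRow-unique : ∀ i i′ x → OnRow i x → OnRow i′ x → i ≡ i′
  OnRow-unique i i′ (rowPt _ j o) (e , _) (e′ , _) = trans (sym e) e′

  OnRowBetween : ℕ → ℕ → ℕ → Point → Set
  OnRowBetween i lo hi x = OnRow i x × lo ≤ position x × position x ≤ hi

  record Trail (P : Point → Set) (p q : Point) (t : List Point) : Set where
    field
      trail-walk : Walk (map vertexAt (p ∷ t))
      trail-last : lastOf p t ≡ q
      trail-all : All P (p ∷ t)
      trail-unique : Unique (p ∷ t)
  open Trail public

  Trail-map : ∀ {P Q : Point → Set} {p q t} → (∀ {x} → P x → Q x) → Trail P p q t → Trail Q p q t
  Trail-map f tr = record
    { trail-walk = trail-walk tr ; trail-last = trail-last tr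
    ; trail-all = All.map f (trail-all tr) ; trail-unique = trail-unique tr }

  Trail-∷ : ∀ {P : Point → Set} {x p q t} → P x → WE W s (vertexAt x) (vertexAt p) → All (x ≢_) (p ∷ t) →
            Trail P p q t → Trail P x q (p ∷ t)
  Trail-∷ px e x∉ tr = record
    { trail-walk = cons _ _ _ e (trail-walk tr) ; trail-last = trail-last tr
    ; trail-all = px ∷ trail-all tr ; trail-unique = x∉ ∷ trail-unique tr }

  Trail-bridge : ∀ {P R Q : Point → Set} {p r r′ q t₁ t₂} (V : List Point) →
    Trail P p r t₁ → (∀ rest → Walk (map vertexAt (r′ ∷ rest)) → Walk (map vertexAt (r ∷ V ++ r′ ∷ rest))) →
    Unique V → All R V → Trail Q r′ q t₂ →
    (∀ x → P x → R x → ⊥) → (∀ x → P x → Q x → ⊥) → (∀ x → R x → Q x → ⊥) →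
    Trail (λ x → P x ⊎ R x ⊎ Q x) p q (t₁ ++ V ++ r′ ∷ t₂)
  Trail-bridge {p = p} {r′ = r′} {t₁ = t₁} {t₂} V tr₁ bridge uV aV tr₂ dPR dPQ dRQ = record
    { trail-walk = Walk-++-vertexAt p t₁ (V ++ r′ ∷ t₂) (trail-walk tr₁)
        (subst (λ z → Walk (map vertexAt (z ∷ V ++ r′ ∷ t₂))) (sym (trail-last tr₁)) (bridge t₂ (trail-walk tr₂)))
    ; trail-last = begin
        lastOf p (t₁ ++ V ++ r′ ∷ t₂)   ≡⟨ cong (lastOf p) (sym (++-assoc t₁ V (r′ ∷ t₂))) ⟩
        lastOf p ((t₁ ++ V) ++ r′ ∷ t₂) ≡⟨ lastOf-++ p (t₁ ++ V) r′ t₂ ⟩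
        lastOf r′ t₂                    ≡⟨ trail-last tr₂ ⟩
        _                               ∎
    ; trail-all = All++.++⁺ (All.map inj₁ (trail-all tr₁))
        (All++.++⁺ (All.map (inj₂ ∘ inj₁) aV) (All.map (inj₂ ∘ inj₂) (trail-all tr₂)))
    ; trail-unique = Unique-++ (trail-unique tr₁) (Unique-++ uV (trail-unique tr₂) aV (trail-all tr₂) dRQ)
        (trail-all tr₁) (All++.++⁺ (All.map inj₁ aV) (All.map inj₂ (trail-all tr₂)))
        (λ { x px (inj₁ rx) → dPR x px rx ; x px (inj₂ qx) → dPQ x px qx }) }
    where open ≡-Reasoning

  run-trail : ∀ i p q n → OnRow i p → OnRow i q → position p + n ≡ position q →
              Trail (OnRowBetween i (position p) (position q)) p q (steps p n)
  run-trail i p q zero op oq p+0≡q = record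
    { trail-walk = single _
    ; trail-last = OnRow-position-injective i p q op oq p≡q
    ; trail-all = (op , ≤-refl , ≤-reflexive p≡q) ∷ []
    ; trail-unique = [] ∷ [] }
    where p≡q = trans (sym (+-identityʳ _)) p+0≡q
  run-trail i p q (suc n) op oq p+1+n≡q =
    Trail-∷ (op , ≤-refl , p≤q) (next-edge i p op)
      (All.map (λ (_ , next≤x , _) p≡x → <-irrefl (cong position p≡x) (<-≤-trans (≤-reflexive (sym next≡)) next≤x))
        (trail-all rest))
      (Trail-map (λ (ox , next≤x , x≤q) → ox , ≤-trans (n≤1+n _) (subst (_≤ _) next≡ next≤x) , x≤q) rest)
    where
    p<p+1+n : suc (position p) ≤ position q
    p<p+1+n = subst (suc (position p) ≤_) p+1+n≡q (m<m+n (position p) (s≤s z≤n))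
    p≤q : position p ≤ position q
    p≤q = <⇒≤ p<p+1+n
    next≡ : position (next p) ≡ suc (position p)
    next≡ = position-next i p op (≤-<-trans p<p+1+n (OnRow⇒position<rowLength i q oq))
    rest : Trail (OnRowBetween i (position (next p)) (position q)) (next p) q (steps (next p) n)
    rest = run-trail i (next p) q n (next-OnRow i p op) oq
             (trans (cong (_+ n) next≡) (trans (sym (+-suc (position p) n)) p+1+n≡q))

  runTo : Point → Point → List Point
  runTo p q = steps p (position q ∸ position p)

  runTo-trail : ∀ i p q → OnRow i p → OnRow i q → position p ≤ position q →
                Trail (OnRowBetween i (position p) (position q)) p q (runTo p q)
  runTo-trail i p q op oq p≤q = run-trail i p q _ op oq (m+[n∸m]≡n p≤q)

  originPt lastPt : ℕ → Point
  originPt i = rowPt i 0 0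
  lastPt i = rowPt i (pred C) (pred (segLengthℕ i (pred C)))

  originPt-OnRow : ∀ i → i < W → OnRow i (originPt i)
  originPt-OnRow i iw = refl , iw , s≤s z≤n , s≤s z≤n

  lastPt-OnRow : ∀ i → i < W → OnRow i (lastPt i)
  lastPt-OnRow i iw = refl , iw , ≤-refl , ≤-refl

  lastPt-position : ∀ i → suc (position (lastPt i)) ≡ rowLength i
  lastPt-position i = sym (+-suc (segStart i (pred C)) _)

  next-lastPt : ∀ i → next (lastPt i) ≡ originPt i
  next-lastPt i with suc (pred (segLengthℕ i (pred C))) <? segLengthℕ i (pred C)
  ... | yes p = ⊥-elim (<-irrefl refl p)
  ... | no _ = cong (λ z → rowPt i z 0) (nextColℕ-last (pred C) refl)

  wrapRun : ℕ → Point → Point → List Point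
  wrapRun i p q = runTo p (lastPt i) ++ originPt i ∷ runTo (originPt i) q

  OnRowWrapping : ℕ → ℕ → ℕ → Point → Set
  OnRowWrapping i lo hi x = OnRowBetween i lo (position (lastPt i)) x ⊎ OnRowBetween i 0 hi x

  wrapRun-trail : ∀ i p q → OnRow i p → OnRow i q → position q < position p →
                  Trail (OnRowWrapping i (position p) (position q)) p q (wrapRun i p q)
  wrapRun-trail i p q op oq q<p =
    Trail-map (λ { (inj₁ x) → inj₁ x ; (inj₂ (inj₂ x)) → inj₂ x })
      (Trail-bridge {R = λ _ → ⊥} [] toEnd
        (λ rest w → cons _ _ _ (subst (WE W s (vertexAt (lastPt i)) ∘ vertexAt) (next-lastPt i) (next-edge i (lastPt i) (lastPt-OnRow i iw))) w)
        [] [] fromStart (λ _ _ ()) disjoint (λ _ ()))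
    where
    iw = OnRow⇒<W i p op
    toEnd = runTo-trail i p (lastPt i) op (lastPt-OnRow i iw)
              (≤-pred (subst (position p <_) (sym (lastPt-position i)) (OnRow⇒position<rowLength i p op)))
    fromStart = runTo-trail i (originPt i) q (originPt-OnRow i iw) oq z≤n
    disjoint : ∀ x → OnRowBetween i (position p) (position (lastPt i)) x → OnRowBetween i 0 (position q) x → ⊥
    disjoint x (_ , p≤x , _) (_ , _ , x≤q) = <-irrefl refl (<-≤-trans q<p (≤-trans p≤x x≤q))

  -- Vertical runs along a column

  inBlock : ℕ → ℕ → List Point
  inBlock r c = rowPt r c 0 ∷ steps (rowPt r c 0) (outIndexℕ r c)

  outPt-OnRow : ∀ r c → r < W → c < C → OnRow r (rowPt r c (outIndexℕ r c))
  outPt-OnRow r c rw cc = refl , rw , cc , s≤s (m≤m+n _ _)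

  inBlock-trail : ∀ r c → r < W → c < C →
    Trail (OnRowBetween r (segStart r c) (segStart r c + outIndexℕ r c)) (rowPt r c 0) (rowPt r c (outIndexℕ r c)) (steps (rowPt r c 0) (outIndexℕ r c))
  inBlock-trail r c rw cc =
    subst (λ lo → Trail (OnRowBetween r lo (segStart r c + outIndexℕ r c)) (rowPt r c 0) (rowPt r c (outIndexℕ r c)) (steps (rowPt r c 0) (outIndexℕ r c)))
      (+-identityʳ _)
      (run-trail r (rowPt r c 0) (rowPt r c (outIndexℕ r c)) (outIndexℕ r c) (refl , rw , cc , s≤s z≤n) (outPt-OnRow r c rw cc)
        (cong (_+ outIndexℕ r c) (+-identityʳ (segStart r c))))

  rungPts : ℕ → ℕ → List Point
  rungPts r c = map (rungPt r c) (range 0 (rungLength r c))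

  OnRung : ℕ → ℕ → Point → Set
  OnRung r c x = Σ ℕ λ t → x ≡ rungPt r c t × Valid x

  rungPts-OnRung : ∀ r c → c < C → All (OnRung r c) (rungPts r c)
  rungPts-OnRung r c cc = All++.map⁺ (All.map (λ { {t} (_ , t<) → t , refl , cc , t< }) (range-bounds 0 (rungLength r c)))

  rungPts-Unique : ∀ r c → Unique (rungPts r c)
  rungPts-Unique r c = Uq.map⁺ (λ { refl → refl }) (range-Unique 0 (rungLength r c))

  OnRung⇒¬OnRow : ∀ r c i x → OnRung r c x → OnRow i x → ⊥
  OnRung⇒¬OnRow r c i .(rungPt r c t) (t , refl , _) ()

  OnRung-unique : ∀ r c r′ c′ x → OnRung r c x → OnRung r′ c′ x → (r ≡ r′) × (c ≡ c′)
  OnRung-unique r c r′ c′ .(rungPt r c t) (t , refl , _) (t′ , refl , _) = refl , refl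

  map-vertexAt-rungPts : ∀ i j {x y} (e : EE W x y) → rungLength i j ≡ s e → (∀ t → rungVertex i j t ≡ edgeSubVertex e t) →
    map vertexAt (rungPts i j) ≡ map (edgeSubVertex e) (range 0 (s e))
  map-vertexAt-rungPts i j e len≡ vertex≡ = begin
    map vertexAt (map (rungPt i j) (range 0 (rungLength i j))) ≡⟨ sym (map-∘ (range 0 (rungLength i j))) ⟩
    map (rungVertex i j) (range 0 (rungLength i j))           ≡⟨ map-cong vertex≡ _ ⟩
    map (edgeSubVertex e) (range 0 (rungLength i j))          ≡⟨ cong (map (edgeSubVertex e) ∘ range 0) len≡ ⟩
    map (edgeSubVertex e) (range 0 (s e))                     ∎
    where open ≡-Reasoning

  Walk-rung : ∀ i j r r′ rest (e : EE W (vout W (rowFin r) (colFin j)) (vin W (rowFin r′) (colFin j))) →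
    rungLength i j ≡ s e → (∀ t → rungVertex i j t ≡ edgeSubVertex e t) → Walk (map vertexAt (rowPt r′ j 0 ∷ rest)) →
    Walk (map vertexAt (rowPt r j (outIndexℕ r j) ∷ rungPts i j ++ rowPt r′ j 0 ∷ rest))
  Walk-rung i j r r′ rest e len≡ vertex≡ w =
    subst Walk (sym shape)
      (subst (λ z → Walk (z ∷ map (edgeSubVertex e) (range 0 (s e)) ++ map vertexAt (rowPt r′ j 0 ∷ rest)))
        (sym (segVertex-outIndex (rowFin r) (colFin j))) (Walk-edge e (map vertexAt rest) w))
    where
    shape : map vertexAt (rowPt r j (outIndexℕ r j) ∷ rungPts i j ++ rowPt r′ j 0 ∷ rest)
            ≡ vertexAt (rowPt r j (outIndexℕ r j)) ∷ map (edgeSubVertex e) (range 0 (s e)) ++ map vertexAt (rowPt r′ j 0 ∷ rest)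
    shape = cong (_ ∷_) (trans (map-++ vertexAt (rungPts i j) _) (cong (_++ _) (map-vertexAt-rungPts i j e len≡ vertex≡)))

  Walk-down : ∀ i j rest → suc i < W → j < C → j % 2 ≡ 0 → Walk (map vertexAt (rowPt (suc i) j 0 ∷ rest)) →
    Walk (map vertexAt (rowPt i j (outIndexℕ i j) ∷ rungPts i j ++ rowPt (suc i) j 0 ∷ rest))
  Walk-down i j rest i+1<W j<C even w =
    let (e , len≡ , vertex≡) = downEdge i j i+1<W j<C even in Walk-rung i j i (suc i) rest e len≡ vertex≡ w

  Walk-up : ∀ i j rest → suc i < W → j < C → ¬ (j % 2 ≡ 0) → Walk (map vertexAt (rowPt i j 0 ∷ rest)) →
    Walk (map vertexAt (rowPt (suc i) j (outIndexℕ (suc i) j) ∷ rungPts i j ++ rowPt i j 0 ∷ rest))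
  Walk-up i j rest i+1<W j<C odd w =
    let (e , len≡ , vertex≡) = upEdge i j i+1<W j<C odd in Walk-rung i j (suc i) i rest e len≡ vertex≡ w

  -- the interior of the vertical route along column c between the cycles r1 and r2
  InColumn : ℕ → ℕ → ℕ → Point → Set
  InColumn c r1 r2 x = (Σ ℕ λ r → r1 ≤ r × r < r2 × OnRung r c x)
                     ⊎ (Σ ℕ λ r → r1 < r × r < r2 × OnRowBetween r (segStart r c) (segStart r c + outIndexℕ r c) x)

  InColumn-weaken : ∀ c r1 r2 r1′ r2′ x → r1′ ≤ r1 → r2 ≤ r2′ → InColumn c r1 r2 x → InColumn c r1′ r2′ x
  InColumn-weaken c r1 r2 r1′ r2′ x a b (inj₁ (r , p , q , z)) = inj₁ (r , ≤-trans a p , <-≤-trans q b , z)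
  InColumn-weaken c r1 r2 r1′ r2′ x a b (inj₂ (r , p , q , z)) = inj₂ (r , <-≤-trans (s≤s a) p , <-≤-trans q b , z)

  inBlock-OnRowBetween : ∀ r c → r < W → c < C → All (OnRowBetween r (segStart r c) (segStart r c + outIndexℕ r c)) (inBlock r c)
  inBlock-OnRowBetween r c rw cc = trail-all (inBlock-trail r c rw cc)

  columnDown : ℕ → ℕ → ℕ → List Point
  columnDown c r zero = rungPts r c
  columnDown c r (suc d) = rungPts r c ++ (inBlock (suc r) c ++ columnDown c (suc r) d)

  columnUp : ℕ → ℕ → ℕ → List Point
  columnUp c lo zero = rungPts lo c
  columnUp c lo (suc d) = rungPts (suc (lo + d)) c ++ (inBlock (suc (lo + d)) c ++ columnUp c lo d)

  columnDown-Walk : ∀ c r d rest → suc (r + d) < W → c < C → c % 2 ≡ 0 → Walk (map vertexAt (rowPt (suc (r + d)) c 0 ∷ rest)) →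
            Walk (map vertexAt (rowPt r c (outIndexℕ r c) ∷ columnDown c r d ++ rowPt (suc (r + d)) c 0 ∷ rest))
  columnDown-Walk c r zero rest rw cc pe w =
    subst (λ z → Walk (map vertexAt (rowPt r c (outIndexℕ r c) ∷ rungPts r c ++ rowPt (suc z) c 0 ∷ rest))) (sym (+-identityʳ r))
      (Walk-down r c rest (subst (λ z → suc z < W) (+-identityʳ r) rw) cc pe (subst (λ z → Walk (map vertexAt (rowPt (suc z) c 0 ∷ rest))) (+-identityʳ r) w))
  columnDown-Walk c r (suc d) rest rw cc pe w =
    subst (λ z → Walk (map vertexAt (rowPt r c (outIndexℕ r c) ∷ z))) (sym eqA)
      (Walk-down r c (steps B (outIndexℕ (suc r) c) ++ (columnDown c (suc r) d ++ L ∷ rest)) r1 cc pe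
        (Walk-++-vertexAt B (steps B (outIndexℕ (suc r) c)) (columnDown c (suc r) d ++ L ∷ rest) (trail-walk (inBlock-trail (suc r) c r1 cc))
          (subst (λ z → Walk (map vertexAt (z ∷ columnDown c (suc r) d ++ L ∷ rest))) (sym (trail-last (inBlock-trail (suc r) c r1 cc)))
            (subst (λ z → Walk (map vertexAt (rowPt (suc r) c (outIndexℕ (suc r) c) ∷ columnDown c (suc r) d ++ rowPt (suc z) c 0 ∷ rest))) (sym (+-suc r d))
              (columnDown-Walk c (suc r) d rest (subst (λ z → suc z < W) (+-suc r d) rw) cc pe
                (subst (λ z → Walk (map vertexAt (rowPt (suc z) c 0 ∷ rest))) (+-suc r d) w))))))
    where
    B = rowPt (suc r) c 0
    L = rowPt (suc (r + suc d)) c 0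
    r1 : suc r < W
    r1 = ≤-<-trans (s≤s (m≤m+n r (suc d))) rw
    eqA : (rungPts r c ++ (inBlock (suc r) c ++ columnDown c (suc r) d)) ++ L ∷ rest ≡ rungPts r c ++ (B ∷ steps B (outIndexℕ (suc r) c) ++ (columnDown c (suc r) d ++ L ∷ rest))
    eqA = trans (++-assoc (rungPts r c) _ _) (cong (rungPts r c ++_) (++-assoc (inBlock (suc r) c) (columnDown c (suc r) d) (L ∷ rest)))

  columnUp-Walk : ∀ c lo d rest → suc (lo + d) < W → c < C → ¬ (c % 2 ≡ 0) → Walk (map vertexAt (rowPt lo c 0 ∷ rest)) →
            Walk (map vertexAt (rowPt (suc (lo + d)) c (outIndexℕ (suc (lo + d)) c) ∷ columnUp c lo d ++ rowPt lo c 0 ∷ rest))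
  columnUp-Walk c lo zero rest rw cc pe w =
    subst (λ z → Walk (map vertexAt (rowPt (suc z) c (outIndexℕ (suc z) c) ∷ rungPts lo c ++ rowPt lo c 0 ∷ rest))) (sym (+-identityʳ lo))
      (Walk-up lo c rest (subst (λ z → suc z < W) (+-identityʳ lo) rw) cc pe w)
  columnUp-Walk c lo (suc d) rest rw cc pe w =
    subst (λ z → Walk (map vertexAt (rowPt T c (outIndexℕ T c) ∷ z))) (sym eqA)
      (subst (λ z → Walk (map vertexAt (rowPt z c (outIndexℕ z c) ∷ rungPts M c ++ (B ∷ steps B (outIndexℕ M c) ++ (columnUp c lo d ++ rowPt lo c 0 ∷ rest))))) (cong suc (sym (+-suc lo d)))
      (Walk-up M c (steps B (outIndexℕ M c) ++ (columnUp c lo d ++ rowPt lo c 0 ∷ rest)) (subst (_< W) (cong suc (+-suc lo d)) rw) cc pe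
        (Walk-++-vertexAt B (steps B (outIndexℕ M c)) (columnUp c lo d ++ rowPt lo c 0 ∷ rest) (trail-walk (inBlock-trail M c m1 cc))
          (subst (λ z → Walk (map vertexAt (z ∷ columnUp c lo d ++ rowPt lo c 0 ∷ rest))) (sym (trail-last (inBlock-trail M c m1 cc)))
              (columnUp-Walk c lo d rest m1 cc pe w)))))
    where
    T = suc (lo + suc d)
    M = suc (lo + d)
    B = rowPt M c 0
    m1 : M < W
    m1 = ≤-<-trans (s≤s (+-monoʳ-≤ lo (n≤1+n d))) rw
    eqA : (rungPts M c ++ (inBlock M c ++ columnUp c lo d)) ++ rowPt lo c 0 ∷ rest ≡ rungPts M c ++ (B ∷ steps B (outIndexℕ M c) ++ (columnUp c lo d ++ rowPt lo c 0 ∷ rest))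
    eqA = trans (++-assoc (rungPts M c) _ _) (cong (rungPts M c ++_) (++-assoc (inBlock M c) (columnUp c lo d) (rowPt lo c 0 ∷ rest)))

  columnDown-InColumn : ∀ c r d → suc (r + d) < W → c < C → All (InColumn c r (suc (r + d))) (columnDown c r d)
  columnDown-InColumn c r zero rw cc = All.map (λ z → inj₁ (r , ≤-refl , s≤s (m≤m+n r 0) , z)) (rungPts-OnRung r c cc)
  columnDown-InColumn c r (suc d) rw cc =
    All++.++⁺ (All.map (λ z → inj₁ (r , ≤-refl , s≤s (m≤m+n r (suc d)) , z)) (rungPts-OnRung r c cc))
      (All++.++⁺ (All.map (λ z → inj₂ (suc r , ≤-refl , s≤s (≤-trans (s≤s (m≤m+n r d)) (≤-reflexive (sym (+-suc r d)))) , z)) (inBlock-OnRowBetween (suc r) c r1 cc))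
        (All.map (InColumn-weaken c (suc r) (suc (suc r + d)) r (suc (r + suc d)) _ (n≤1+n r) (≤-reflexive (cong suc (sym (+-suc r d)))))
          (columnDown-InColumn c (suc r) d (subst (λ z → suc z < W) (+-suc r d) rw) cc)))
    where r1 : suc r < W
          r1 = ≤-<-trans (s≤s (m≤m+n r (suc d))) rw

  columnDown-Unique : ∀ c r d → suc (r + d) < W → c < C → Unique (columnDown c r d)
  columnDown-Unique c r zero rw cc = rungPts-Unique r c
  columnDown-Unique c r (suc d) rw cc =
    Unique-++ {P = OnRung r c} {Q = λ x → OnRowBetween (suc r) (segStart (suc r) c) (segStart (suc r) c + outIndexℕ (suc r) c) x ⊎ InColumn c (suc r) (suc (suc r + d)) x}
      (rungPts-Unique r c)
      (Unique-++ (trail-unique (inBlock-trail (suc r) c r1 cc)) (columnDown-Unique c (suc r) d r2 cc) (inBlock-OnRowBetween (suc r) c r1 cc) (columnDown-InColumn c (suc r) d r2 cc) f1)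
      (rungPts-OnRung r c cc)
      (All++.++⁺ (All.map inj₁ (inBlock-OnRowBetween (suc r) c r1 cc)) (All.map inj₂ (columnDown-InColumn c (suc r) d r2 cc)))
      f2
    where
    r1 : suc r < W
    r1 = ≤-<-trans (s≤s (m≤m+n r (suc d))) rw
    r2 : suc (suc r + d) < W
    r2 = subst (λ z → suc z < W) (+-suc r d) rw
    f1 : ∀ x → OnRowBetween (suc r) (segStart (suc r) c) (segStart (suc r) c + outIndexℕ (suc r) c) x → InColumn c (suc r) (suc (suc r + d)) x → ⊥
    f1 x (o , _) (inj₁ (r' , _ , _ , iv)) = OnRung⇒¬OnRow r' c (suc r) x iv o
    f1 x (o , _) (inj₂ (r' , lt , _ , (o' , _))) = <-irrefl (OnRow-unique _ _ x o o') lt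
    f2 : ∀ x → OnRung r c x → OnRowBetween (suc r) (segStart (suc r) c) (segStart (suc r) c + outIndexℕ (suc r) c) x ⊎ InColumn c (suc r) (suc (suc r + d)) x → ⊥
    f2 x iv (inj₁ (o , _)) = OnRung⇒¬OnRow r c (suc r) x iv o
    f2 x iv (inj₂ (inj₁ (r' , le , _ , iv'))) = <-irrefl (proj₁ (OnRung-unique r c r' c x iv iv')) le
    f2 x iv (inj₂ (inj₂ (r' , _ , _ , (o , _)))) = OnRung⇒¬OnRow r c r' x iv o

  columnUp-InColumn : ∀ c lo d → suc (lo + d) < W → c < C → All (InColumn c lo (suc (lo + d))) (columnUp c lo d)
  columnUp-InColumn c lo zero rw cc = All.map (λ z → inj₁ (lo , ≤-refl , s≤s (m≤m+n lo 0) , z)) (rungPts-OnRung lo c cc)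
  columnUp-InColumn c lo (suc d) rw cc =
    All++.++⁺ (All.map (λ z → inj₁ (M , ≤-trans (m≤m+n lo d) (n≤1+n _) , s≤s (≤-reflexive (sym (+-suc lo d))) , z)) (rungPts-OnRung M c cc))
      (All++.++⁺ (All.map (λ z → inj₂ (M , s≤s (m≤m+n lo d) , s≤s (≤-reflexive (sym (+-suc lo d))) , z)) (inBlock-OnRowBetween M c m1 cc))
        (All.map (InColumn-weaken c lo (suc (lo + d)) lo (suc (lo + suc d)) _ ≤-refl (s≤s (+-monoʳ-≤ lo (n≤1+n d))))
          (columnUp-InColumn c lo d m1 cc)))
    where M = suc (lo + d)
          m1 : M < W
          m1 = ≤-<-trans (s≤s (+-monoʳ-≤ lo (n≤1+n d))) rw

  columnUp-Unique : ∀ c lo d → suc (lo + d) < W → c < C → Unique (columnUp c lo d)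
  columnUp-Unique c lo zero rw cc = rungPts-Unique lo c
  columnUp-Unique c lo (suc d) rw cc =
    Unique-++ {P = OnRung M c} {Q = λ x → OnRowBetween M (segStart M c) (segStart M c + outIndexℕ M c) x ⊎ InColumn c lo M x}
      (rungPts-Unique M c)
      (Unique-++ (trail-unique (inBlock-trail M c m1 cc)) (columnUp-Unique c lo d m1 cc) (inBlock-OnRowBetween M c m1 cc) (columnUp-InColumn c lo d m1 cc) f1)
      (rungPts-OnRung M c cc)
      (All++.++⁺ (All.map inj₁ (inBlock-OnRowBetween M c m1 cc)) (All.map inj₂ (columnUp-InColumn c lo d m1 cc)))
      f2
    where
    M = suc (lo + d)
    m1 : M < W
    m1 = ≤-<-trans (s≤s (+-monoʳ-≤ lo (n≤1+n d))) rw
    f1 : ∀ x → OnRowBetween M (segStart M c) (segStart M c + outIndexℕ M c) x → InColumn c lo M x → ⊥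
    f1 x (o , _) (inj₁ (r' , _ , _ , iv)) = OnRung⇒¬OnRow r' c M x iv o
    f1 x (o , _) (inj₂ (r' , _ , lt , (o' , _))) = <-irrefl (OnRow-unique _ _ x o' o) lt
    f2 : ∀ x → OnRung M c x → OnRowBetween M (segStart M c) (segStart M c + outIndexℕ M c) x ⊎ InColumn c lo M x → ⊥
    f2 x iv (inj₁ (o , _)) = OnRung⇒¬OnRow M c M x iv o
    f2 x iv (inj₂ (inj₁ (r' , _ , lt , iv'))) = <-irrefl (sym (proj₁ (OnRung-unique M c r' c x iv iv'))) lt
    f2 x iv (inj₂ (inj₂ (r' , _ , _ , (o , _)))) = OnRung⇒¬OnRow M c r' x iv o

  InColumn-OnRow : ∀ c r1 r2 i x → OnRow i x → InColumn c r1 r2 x → r1 < i × i < r2 × segStart i c ≤ position x × position x ≤ segStart i c + outIndexℕ i c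
  InColumn-OnRow c r1 r2 i x oi (inj₁ (r , _ , _ , iv)) = ⊥-elim (OnRung⇒¬OnRow r c i x iv oi)
  InColumn-OnRow c r1 r2 i x oi (inj₂ (r , a , b , (o , l , u))) with OnRow-unique r i x o oi
  ... | refl = a , b , l , u

  inBlock<segStart-suc : ∀ i c → segStart i c + outIndexℕ i c < segStart i (suc c)
  inBlock<segStart-suc i c = +-monoʳ-< (segStart i c) (s≤s (m≤m+n _ _))

  record CycleCoords (x : WV W s) (i : ℕ) : Set where
    field
      cc-column cc-offset : ℕ
      cc-OnRow : OnRow i (rowPt i cc-column cc-offset)
      cc-vertexAt : vertexAt (rowPt i cc-column cc-offset) ≡ x
      cc-coords : coords x ≡ rowPt i cc-column cc-offset
  open CycleCoords public

  cycleCoords : ∀ x I → OnCycle W s x I → CycleCoords x (toℕ I)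
  cycleCoords x I oc with OnCycle⇒coords x I oc
  ... | (J , o , ky , ol , el) = record
    { cc-column = toℕ J ; cc-offset = o
    ; cc-OnRow = refl , toℕ<n I , toℕ<n J , subst (o <_) (sym (cong₂ segLength (rowFin-toℕ I) (colFin-toℕ J))) ol
    ; cc-vertexAt = trans (cong₂ (λ a b → segVertex a b o) (rowFin-toℕ I) (colFin-toℕ J)) el
    ; cc-coords = ky }

  OnP11⇒column0 : ∀ x i j o → OnP11 W s x → coords x ≡ rowPt i j o → j ≡ 0
  OnP11⇒column0 (orig (v i j)) _ _ _ p refl = p
  OnP11⇒column0 (orig (v' i j m)) _ _ _ p refl = p
  OnP11⇒column0 (sub (split i j m) t) _ _ _ (c , refl , p) refl = p
  OnP11⇒column0 (sub (cyc i j j' q) t) _ _ _ (c , () , p) _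
  OnP11⇒column0 (sub (cycwrap i j j' q r) t) _ _ _ (c , () , p) _
  OnP11⇒column0 (sub (down i i' j q r) t) _ _ _ _ ()
  OnP11⇒column0 (sub (up i i' j q r) t) _ _ _ _ ()

module Matching (k W : ℕ) (α β : Fin k → ℕ)
         (αinj : ∀ a b → α a ≡ α b → a ≡ b) (βinj : ∀ a b → β a ≡ β b → a ≡ b)
         (α<W : ∀ a → α a < W) (β<W : ∀ a → β a < W)
         (Reach : Fin k → Fin k → Set) (reach? : ∀ a b → Dec (Reach a b)) (halfStart : ℕ) where

  Direct : Fin k → Set
  Direct a = Σ (Fin k) λ b → β b ≡ α a × Reach a b

  direct? : ∀ a → Dec (Direct a)
  direct? a = any? (λ b → (β b ≟ α a) ×-dec reach? a b)

  Taken : Fin k → Set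
  Taken b = Σ (Fin k) λ a → α a ≡ β b × Reach a b

  MoverRow : ℕ → Set
  MoverRow r = Σ (Fin k) λ a → α a ≡ r × ¬ Direct a
  moverRow? : Decidable MoverRow
  moverRow? r = any? (λ a → (α a ≟ r) ×-dec ¬? (direct? a))

  taken? : ∀ b → Dec (Taken b)
  taken? b = any? (λ a → (α a ≟ β b) ×-dec reach? a b)

  FreeTargetRow : ℕ → Set
  FreeTargetRow r = Σ (Fin k) λ b → β b ≡ r × ¬ Taken b
  freeTargetRow? : Decidable FreeTargetRow
  freeTargetRow? r = any? (λ b → (β b ≟ r) ×-dec ¬? (taken? b))

  DirectRow : ℕ → Set
  DirectRow r = Σ (Fin k) λ a → α a ≡ r × Direct a
  directRow? : Decidable DirectRow
  directRow? r = any? (λ a → (α a ≟ r) ×-dec direct? a)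

  TakenRow : ℕ → Set
  TakenRow r = Σ (Fin k) λ b → β b ≡ r × Taken b
  takenRow? : Decidable TakenRow
  takenRow? r = any? (λ b → (β b ≟ r) ×-dec taken? b)

  sources-by-kind : count (inImage? α) W ≡ count moverRow? W + count directRow? W
  sources-by-kind = count-⊎ (inImage? α) moverRow? directRow?
         (λ { r (a , e) → byDirect a e (direct? a) })
         (λ { r (a , e , _) → a , e }) (λ { r (a , e , _) → a , e })
         (λ { r (a , e , nd) (a' , e' , d) → nd (subst Direct (αinj a' a (trans e' (sym e))) d) }) W
    where byDirect : ∀ {r} a → α a ≡ r → Dec (Direct a) → MoverRow r ⊎ DirectRow r
          byDirect a e (yes d) = inj₂ (a , e , d)
          byDirect a e (no nd) = inj₁ (a , e , nd)

  targets-by-kind : count (inImage? β) W ≡ count freeTargetRow? W + count takenRow? W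
  targets-by-kind = count-⊎ (inImage? β) freeTargetRow? takenRow?
         (λ { r (a , e) → byTaken a e (taken? a) })
         (λ { r (a , e , _) → a , e }) (λ { r (a , e , _) → a , e })
         (λ { r (a , e , nd) (a' , e' , d) → nd (subst Taken (βinj a' a (trans e' (sym e))) d) }) W
    where byTaken : ∀ {r} a → β a ≡ r → Dec (Taken a) → FreeTargetRow r ⊎ TakenRow r
          byTaken a e (yes d) = inj₂ (a , e , d)
          byTaken a e (no nd) = inj₁ (a , e , nd)

  directRows≡takenRows : count directRow? W ≡ count takenRow? W
  directRows≡takenRows = count-cong directRow? takenRow? (λ { r (a , e , (b , eb , bd)) → b , trans eb e , a , sym eb , bd })
                       (λ { r (b , e , (a , ea , bd)) → a , trans ea e , b , sym ea , bd }) W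

  movers : ℕ
  movers = count moverRow? W

  movers≡freeTargets : movers ≡ count freeTargetRow? W
  movers≡freeTargets = +-cancelʳ-≡ (count directRow? W) movers (count freeTargetRow? W) eq
    where
    eq : movers + count directRow? W ≡ count freeTargetRow? W + count directRow? W
    eq = trans (sym sources-by-kind) (trans (count-inImage α αinj W α<W) (trans (sym (count-inImage β βinj W β<W)) (trans targets-by-kind (cong (count freeTargetRow? W +_) (sym directRows≡takenRows)))))

  movers≤k : movers ≤ k
  movers≤k = subst (movers ≤_) (count-inImage α αinj W α<W) (subst (movers ≤_) (sym sources-by-kind) (m≤m+n _ _))

  rank : Fin k → ℕ
  rank a = count moverRow? (α a)

  rank<movers : ∀ a → ¬ Direct a → rank a < movers
  rank<movers a nd = count-mono-< moverRow? (a , refl , nd) (α<W a)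

  TargetSpec : Fin k → Fin k → Set
  TargetSpec a b = (Direct a × β b ≡ α a × Reach a b) ⊎ (¬ Direct a × ¬ Taken b × count freeTargetRow? (β b) ≡ rank a)

  targetWithSpec : ∀ a → Σ (Fin k) (TargetSpec a)
  targetWithSpec a with direct? a
  ... | yes (b , e , bd) = b , inj₁ ((b , e , bd) , e , bd)
  ... | no nd with count-surjective freeTargetRow? W (rank a) (subst (rank a <_) movers≡freeTargets (rank<movers a nd))
  ...   | (r , _ , (b , e , nu) , c) = b , inj₂ (nd , nu , trans (cong (count freeTargetRow?) e) c)

  target : Fin k → Fin k
  target a = proj₁ (targetWithSpec a)

  target-spec : ∀ a → TargetSpec a (target a)
  target-spec a = proj₂ (targetWithSpec a)

  target-direct : ∀ a → Direct a → β (target a) ≡ α a × Reach a (target a)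
  target-direct a d with target-spec a
  ... | inj₁ (_ , e , bd) = e , bd
  ... | inj₂ (nd , _) = ⊥-elim (nd d)

  target-mover : ∀ a → ¬ Direct a → ¬ Taken (target a) × count freeTargetRow? (β (target a)) ≡ rank a
  target-mover a nd with target-spec a
  ... | inj₁ (d , _) = ⊥-elim (nd d)
  ... | inj₂ (_ , nu , c) = nu , c

  mover-¬Reach : ∀ a → ¬ Direct a → ∀ b → β b ≡ α a → ¬ Reach a b
  mover-¬Reach a nd b e bd = nd (b , e , bd)

  rank-mono : ∀ a a' → ¬ Direct a → α a < α a' → rank a < rank a'
  rank-mono a a' nd lt = count-mono-< moverRow? (a , refl , nd) lt

  target-mono : ∀ a a' → ¬ Direct a → ¬ Direct a' → α a < α a' → β (target a) < β (target a')
  target-mono a a' nd nd' lt with β (target a) <? β (target a')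
  ... | yes p = p
  ... | no np = ⊥-elim (<-irrefl refl (<-≤-trans (rank-mono a a' nd lt)
                   (subst₂ _≤_ (proj₂ (target-mover a' nd')) (proj₂ (target-mover a nd)) (count-mono-≤ freeTargetRow? (≮⇒≥ np)))))

  rank-injective : ∀ a a' → ¬ Direct a → ¬ Direct a' → rank a ≡ rank a' → a ≡ a'
  rank-injective a a' nd nd' e with <-cmp (α a) (α a')
  ... | tri< lt _ _ = ⊥-elim (<-irrefl e (rank-mono a a' nd lt))
  ... | tri≈ _ eq _ = αinj a a' eq
  ... | tri> _ _ gt = ⊥-elim (<-irrefl (sym e) (rank-mono a' a nd' gt))

  target-injective : ∀ a a' → target a ≡ target a' → a ≡ a'
  target-injective a a' e with target-spec a | target-spec a'
  ... | inj₁ (_ , e1 , _) | inj₁ (_ , e2 , _) = αinj a a' (trans (sym e1) (trans (cong β e) e2))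
  ... | inj₁ (_ , e1 , bd) | inj₂ (_ , nu , _) = ⊥-elim (nu (a , trans (sym e1) (cong β e) , subst (Reach a) e bd))
  ... | inj₂ (_ , nu , _) | inj₁ (_ , e2 , bd) = ⊥-elim (nu (a' , trans (sym e2) (cong β (sym e)) , subst (Reach a') (sym e) bd))
  ... | inj₂ (nd , _ , c1) | inj₂ (nd' , _ , c2) = rank-injective a a' nd nd' (trans (sym c1) (trans (cong (λ z → count freeTargetRow? (β z)) e) c2))

  target-reflects-< : ∀ a a' → ¬ Direct a → ¬ Direct a' → β (target a) < β (target a') → α a < α a'
  target-reflects-< a a' nd nd' lt with <-cmp (α a) (α a')
  ... | tri< p _ _ = p
  ... | tri≈ _ eq _ = ⊥-elim (<-irrefl (cong (λ z → β (target z)) (αinj a a' eq)) lt)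
  ... | tri> _ _ gt = ⊥-elim (<-asym lt (target-mono a' a nd' nd gt))

  downCol upCol : Fin k → ℕ
  downCol a = 2 * (halfStart + (movers ∸ suc (rank a)))
  upCol a = suc (2 * (halfStart + rank a))

  col : Fin k → ℕ
  col a with α a <? β (target a)
  ... | yes _ = downCol a
  ... | no _ = upCol a

  col-down : ∀ a → α a < β (target a) → col a ≡ downCol a
  col-down a lt with α a <? β (target a)
  ... | yes _ = refl
  ... | no n = ⊥-elim (n lt)

  col-up : ∀ a → ¬ (α a < β (target a)) → col a ≡ upCol a
  col-up a nlt with α a <? β (target a)
  ... | yes p = ⊥-elim (nlt p)
  ... | no _ = refl

  Between : ℕ → ℕ → ℕ → Set
  Between x y z = (x < z × z < y) ⊎ (y < z × z < x)

  downCol-anti : ∀ a a' → ¬ Direct a → ¬ Direct a' → rank a < rank a' → downCol a' < downCol a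
  downCol-anti a a' nd nd' lt = *-monoʳ-< 2 (+-monoʳ-< halfStart (∸-monoʳ-< (s≤s lt) (rank<movers a' nd')))

  upCol-mono : ∀ a a' → rank a < rank a' → upCol a < upCol a'
  upCol-mono a a' lt = s≤s (*-monoʳ-< 2 (+-monoʳ-< halfStart lt))

  col-<-when-source≡target : ∀ a a' → ¬ a ≡ a' → α a ≡ β (target a') → ¬ Direct a → ¬ Direct a' → col a < col a'
  col-<-when-source≡target a a' ne e nd nd' with <-cmp (α a') (α a)
  ... | tri≈ _ eq _ = ⊥-elim (ne (αinj a a' (sym eq)))
  ... | tri< lt _ _ = subst₂ _<_ (sym (col-down a adown)) (sym (col-down a' a'down)) (downCol-anti a' a nd' nd (rank-mono a' a nd' lt))
    where adown : α a < β (target a)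
          adown = subst (_< β (target a)) (sym e) (target-mono a' a nd' nd lt)
          a'down : α a' < β (target a')
          a'down = subst (α a' <_) e lt
  ... | tri> _ _ gt = subst₂ _<_ (sym (col-up a aup)) (sym (col-up a' a'up)) (upCol-mono a a' (rank-mono a a' nd gt))
    where aup : ¬ (α a < β (target a))
          aup x = <-asym (subst (β (target a) <_) (sym e) (target-mono a a' nd nd' gt)) x
          a'up : ¬ (α a' < β (target a'))
          a'up x = <-asym gt (subst (α a' <_) (sym e) x)

  col-<-when-source-between : ∀ a a' → ¬ Direct a → ¬ Direct a' → Between (α a') (β (target a')) (α a) → ¬ (α a ≡ β (target a)) × col a < col a'
  col-<-when-source-between a a' nd nd' (inj₁ (l1 , l2)) = (λ e → <-irrefl e (<-trans l2 b<)) ,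
        subst₂ _<_ (sym (col-down a (<-trans l2 b<))) (sym (col-down a' (<-trans l1 l2))) (downCol-anti a' a nd' nd (rank-mono a' a nd' l1))
    where b< : β (target a') < β (target a)
          b< = target-mono a' a nd' nd l1
  col-<-when-source-between a a' nd nd' (inj₂ (l1 , l2)) = (λ e → <-irrefl (sym e) (<-trans b< l1)) ,
        subst₂ _<_ (sym (col-up a (λ x → <-asym x (<-trans b< l1)))) (sym (col-up a' (λ x → <-asym x (<-trans l1 l2)))) (upCol-mono a a' (rank-mono a a' nd l2))
    where b< : β (target a) < β (target a')
          b< = target-mono a a' nd nd' l2

  col->-when-target-between : ∀ a a' → ¬ Direct a → ¬ Direct a' → Between (α a') (β (target a')) (β (target a)) → ¬ (α a ≡ β (target a)) × col a' < col a
  col->-when-target-between a a' nd nd' (inj₁ (l1 , l2)) = (λ e → <-irrefl e (<-trans a< l1)) ,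
        subst₂ _<_ (sym (col-down a' (<-trans l1 l2))) (sym (col-down a (<-trans a< l1))) (downCol-anti a a' nd nd' (rank-mono a a' nd a<))
    where a< : α a < α a'
          a< = target-reflects-< a a' nd nd' l2
  col->-when-target-between a a' nd nd' (inj₂ (l1 , l2)) = (λ e → <-irrefl (sym e) (<-trans l2 a<)) ,
        subst₂ _<_ (sym (col-up a' (λ x → <-asym x (<-trans l1 l2)))) (sym (col-up a (λ x → <-asym x (<-trans l2 a<)))) (upCol-mono a' a (rank-mono a' a nd' a<))
    where a< : α a' < α a
          a< = target-reflects-< a' a nd' nd l1

  col-window : ∀ a → ¬ Direct a → 2 * halfStart ≤ col a × col a < 2 * halfStart + 2 * k
  col-window a nd with α a <? β (target a)
  ... | yes _ = *-monoʳ-≤ 2 (m≤m+n halfStart _) ,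
        subst (downCol a <_) (*-distribˡ-+ 2 halfStart k)
          (*-monoʳ-< 2 (+-monoʳ-< halfStart (<-≤-trans (n∸[1+x]<n movers (rank a) (rank<movers a nd)) movers≤k)))
    where
    n∸[1+x]<n : ∀ n x → x < n → n ∸ suc x < n
    n∸[1+x]<n (suc n) x _ = s≤s (m∸n≤m n x)
  ... | no _ = ≤-trans (*-monoʳ-≤ 2 (m≤m+n halfStart _)) (n≤1+n _) ,
        subst (λ t → suc (suc t) ≤ 2 * halfStart + 2 * k) (sym (*-distribˡ-+ 2 halfStart (rank a)))
          (2+x+2y≤x+2z (2 * halfStart) (rank a) k (<-≤-trans (rank<movers a nd) movers≤k))
    where
    2+x+2y≤x+2z : ∀ x y z → y < z → suc (suc (x + 2 * y)) ≤ x + 2 * z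
    2+x+2y≤x+2z x y z y<z = subst (_≤ x + 2 * z) (trans (cong (x +_) (*-suc 2 y)) (trans (+-suc x (suc (2 * y))) (cong suc (+-suc x (2 * y)))))
                              (+-monoʳ-≤ x (*-monoʳ-≤ 2 y<z))

  even-2* : ∀ x → (2 * x) % 2 ≡ 0
  even-2* x = trans (cong (_% 2) (*-comm 2 x)) (m*n%n≡0 x 2)

  odd-1+2* : ∀ x → ¬ ((suc (2 * x)) % 2 ≡ 0)
  odd-1+2* x e = 1+n≢0 (trans (sym (trans (cong (λ z → suc z % 2) (*-comm 2 x)) ([m+kn]%n≡m%n 1 x 2))) e)

  col-even : ∀ a → α a < β (target a) → col a % 2 ≡ 0
  col-even a lt = trans (cong (_% 2) (col-down a lt)) (even-2* (halfStart + (movers ∸ suc (rank a))))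

  col-odd : ∀ a → ¬ (α a < β (target a)) → ¬ (col a % 2 ≡ 0)
  col-odd a nlt e = odd-1+2* (halfStart + rank a) (trans (cong (_% 2) (sym (col-up a nlt))) e)

  ∸-injective : ∀ n x y → x < n → y < n → n ∸ suc x ≡ n ∸ suc y → x ≡ y
  ∸-injective n x y x<n y<n e = suc-injective (+-cancelˡ-≡ (n ∸ suc x) (suc x) (suc y)
    (trans (m∸n+n≡m x<n) (trans (sym (m∸n+n≡m y<n)) (cong (_+ suc y) (sym e)))))

  col-injective : ∀ a a' → ¬ a ≡ a' → ¬ Direct a → ¬ Direct a' → ¬ col a ≡ col a'
  col-injective a a' ne nd nd' e = byDirection (α a <? β (target a)) (α a' <? β (target a'))
    where
    byDirection : Dec (α a < β (target a)) → Dec (α a' < β (target a')) → ⊥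
    byDirection (yes p) (yes p') = ne (rank-injective a a' nd nd' (∸-injective movers (rank a) (rank a') (rank<movers a nd) (rank<movers a' nd')
                           (+-cancelˡ-≡ halfStart _ _ (*-cancelˡ-≡ _ _ 2 (trans (sym (col-down a p)) (trans e (col-down a' p')))))))
    byDirection (yes p) (no p') = col-odd a' p' (trans (cong (_% 2) (sym e)) (col-even a p))
    byDirection (no p) (yes p') = col-odd a p (trans (cong (_% 2) e) (col-even a' p'))
    byDirection (no p) (no p') = ne (rank-injective a a' nd nd' (+-cancelˡ-≡ halfStart _ _ (*-cancelˡ-≡ _ _ 2 (suc-injective (trans (sym (col-up a p)) (trans e (col-up a' p')))))))

k²+k<2k[k+2] : ∀ k → 1 ≤ k → suc (k * k + k) ≤ 2 * k * (k + 2)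
k²+k<2k[k+2] k 1≤k = begin
  suc (k * k + k)                          ≤⟨ +-monoˡ-≤ (k * k + k) 1≤k ⟩
  k + (k * k + k)                          ≤⟨ m≤m+n (k + (k * k + k)) (k * k + 2 * k) ⟩
  (k + (k * k + k)) + (k * k + 2 * k)      ≡⟨ solve 1 (λ k → (k :+ (k :* k :+ k)) :+ (k :* k :+ con 2 :* k) := con 2 :* k :* (k :+ con 2)) refl k ⟩
  2 * k * (k + 2)                          ∎
  where
  open ≤-Reasoning
  open +-*-Solver

module Routing (w0 : ℕ) (s : Subdiv (suc w0)) (k : ℕ) (1≤k : 1 ≤ k) (2k[k+2]≤W : 2 * k * (k + 2) ≤ suc w0)
         (A : Fin k → WV (suc w0) s) (cycleA : Fin k → Fin (suc w0)) (cycleA-injective : ∀ a b → cycleA a ≡ cycleA b → a ≡ b)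
         (A-onCycle : ∀ a → OnCycle (suc w0) s (A a) (cycleA a))
         (B : Fin k → WV (suc w0) s) (cycleB : Fin k → Fin (suc w0)) (cycleB-injective : ∀ a b → cycleB a ≡ cycleB b → a ≡ b)
         (B-onP11 : ∀ b → OnP11 (suc w0) s (B b)) (B-onCycle : ∀ b → OnCycle (suc w0) s (B b) (cycleB b)) where

  open Wall w0 s

  α β : Fin k → ℕ
  α a = toℕ (cycleA a)
  β b = toℕ (cycleB b)

  coordsA : ∀ a → CycleCoords (A a) (α a)
  coordsA a = cycleCoords (A a) (cycleA a) (A-onCycle a)
  coordsB : ∀ b → CycleCoords (B b) (β b)
  coordsB b = cycleCoords (B b) (cycleB b) (B-onCycle b)

  colA offA offB : Fin k → ℕ
  colA a = cc-column (coordsA a)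
  offA a = cc-offset (coordsA a)
  offB b = cc-offset (coordsB b)

  colB≡0 : ∀ b → cc-column (coordsB b) ≡ 0
  colB≡0 b = OnP11⇒column0 (B b) _ _ _ (B-onP11 b) (cc-coords (coordsB b))

  ptA ptB : Fin k → Point
  ptA a = rowPt (α a) (colA a) (offA a)
  ptB b = rowPt (β b) 0 (offB b)

  ptA-OnRow : ∀ a → OnRow (α a) (ptA a)
  ptA-OnRow a = cc-OnRow (coordsA a)
  ptB-OnRow : ∀ b → OnRow (β b) (ptB b)
  ptB-OnRow b = subst (λ z → OnRow (β b) (rowPt (β b) z (offB b))) (colB≡0 b) (cc-OnRow (coordsB b))
  vertexAt-ptA : ∀ a → vertexAt (ptA a) ≡ A a
  vertexAt-ptA a = cc-vertexAt (coordsA a)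
  vertexAt-ptB : ∀ b → vertexAt (ptB b) ≡ B b
  vertexAt-ptB b = subst (λ z → vertexAt (rowPt (β b) z (offB b)) ≡ B b) (colB≡0 b) (cc-vertexAt (coordsB b))

  posA posB : Fin k → ℕ
  posA a = position (ptA a)
  posB b = position (ptB b)

  posB<segStart1 : ∀ b → posB b < segStart (β b) 1
  posB<segStart1 b with ptB-OnRow b
  ... | (_ , _ , _ , ol) = ol

  αinj : ∀ a b → α a ≡ α b → a ≡ b
  αinj a b e = cycleA-injective a b (toℕ-injective e)
  βinj : ∀ a b → β a ≡ β b → a ≡ b
  βinj a b e = cycleB-injective a b (toℕ-injective e)

  windowHalf : ℕ → ℕ
  windowHalf x = suc (k * x)

  WindowFree : ℕ → Set
  WindowFree x = ∀ a → colA a < 2 * windowHalf x ⊎ 2 * windowHalf x + 2 * k ≤ colA a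

  windowFree? : ∀ x → Dec (WindowFree x)
  windowFree? x = all? (λ a → (colA a <? 2 * windowHalf x) ⊎-dec (2 * windowHalf x + 2 * k ≤? colA a))

  windows-disjoint : ∀ x y (a : Fin k) → x < y → 2 * windowHalf x ≤ colA a → colA a < 2 * windowHalf x + 2 * k → 2 * windowHalf y ≤ colA a → colA a < 2 * windowHalf y + 2 * k → ⊥
  windows-disjoint x y a lt l1 u1 l2 u2 = <-irrefl refl (<-≤-trans u1 (≤-trans le l2))
    where
    le : 2 * windowHalf x + 2 * k ≤ 2 * windowHalf y
    le = subst (_≤ 2 * windowHalf y) (*-distribˡ-+ 2 (windowHalf x) k)
           (*-monoʳ-≤ 2 (s≤s (subst (_≤ k * y) (trans (*-suc k x) (+-comm k (k * x))) (*-monoʳ-≤ k lt))))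

  -- Window x spans the columns [2(1 + k x), 2(1 + k x) + 2k).  The windows x ≤ k are pairwise
  -- disjoint and there are only k sources, so by pigeonhole one of them contains no colA a.
  freeWindow : Σ ℕ λ x → x ≤ k × WindowFree x
  freeWindow with any? (λ (x : Fin (suc k)) → windowFree? (toℕ x))
  ... | yes (x , free) = toℕ x , s≤s⁻¹ (toℕ<n x) , free
  ... | no noneFree = ⊥-elim (no-collision (pigeonhole (n<1+n k) occupantOf))
    where
    occupant : ∀ (x : Fin (suc k)) → Σ (Fin k) λ a → ¬ (colA a < 2 * windowHalf (toℕ x) ⊎ 2 * windowHalf (toℕ x) + 2 * k ≤ colA a)
    occupant x = ¬∀⟶∃¬ k _ (λ a → (colA a <? 2 * windowHalf (toℕ x)) ⊎-dec (2 * windowHalf (toℕ x) + 2 * k ≤? colA a)) (λ free → noneFree (x , free))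
    occupantOf : Fin (suc k) → Fin k
    occupantOf x = proj₁ (occupant x)
    no-collision : (∃ λ i → Σ (Fin (suc k)) λ j → Data.Fin._<_ i j × occupantOf i ≡ occupantOf j) → ⊥
    no-collision (i , j , lt , e) = windows-disjoint (toℕ i) (toℕ j) (occupantOf j) lt
        (subst (λ z → 2 * windowHalf (toℕ i) ≤ colA z) e (≮⇒≥ (λ z → proj₂ (occupant i) (inj₁ z))))
        (subst (λ z → colA z < 2 * windowHalf (toℕ i) + 2 * k) e (≰⇒> (λ z → proj₂ (occupant i) (inj₂ z))))
        (≮⇒≥ (λ z → proj₂ (occupant j) (inj₁ z)))
        (≰⇒> (λ z → proj₂ (occupant j) (inj₂ z)))

  halfStart : ℕ
  halfStart = windowHalf (proj₁ freeWindow)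
  windowStart : ℕ
  windowStart = 2 * halfStart
  windowEnd : ℕ
  windowEnd = windowStart + 2 * k

  window-avoids-A : ∀ a → colA a < windowStart ⊎ windowEnd ≤ colA a
  window-avoids-A = proj₂ (proj₂ freeWindow)

  windowEnd≤C : windowEnd ≤ C
  windowEnd≤C = subst (_≤ C) (*-distribˡ-+ 2 halfStart k) (*-monoʳ-≤ 2 (≤-trans (s≤s (+-monoˡ-≤ k (*-monoʳ-≤ k (proj₁ (proj₂ freeWindow)))))
           (≤-trans (k²+k<2k[k+2] k 1≤k) 2k[k+2]≤W)))

  2≤windowStart : 2 ≤ windowStart
  2≤windowStart = *-monoʳ-≤ 2 (s≤s z≤n)

  Reach : Fin k → Fin k → Set
  Reach a b = posA a ≤ posB b ⊎ segStart (α a) windowEnd ≤ posA a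

  reach? : ∀ a b → Dec (Reach a b)
  reach? a b = (posA a ≤? posB b) ⊎-dec (segStart (α a) windowEnd ≤? posA a)

  α<W : ∀ a → α a < W
  α<W a = toℕ<n (cycleA a)
  β<W : ∀ a → β a < W
  β<W a = toℕ<n (cycleB a)

  open Matching k W α β αinj βinj α<W β<W Reach reach? halfStart public

  -- The route of a will stay inside Occupies a: on the cycle of its source, on the cycle of its
  -- target (positions given by the zones), and inside its column of the window.
  SourceZone : Fin k → ℕ → Set
  SourceZone a y = (Direct a × posA a ≤ y × y ≤ posB (target a))
         ⊎ (Direct a × segStart (α a) windowEnd ≤ posA a × (posA a ≤ y ⊎ y ≤ posB (target a)))
         ⊎ (¬ Direct a × α a ≡ β (target a) × (posA a ≤ y ⊎ y ≤ posB (target a)))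
         ⊎ (¬ Direct a × ¬ α a ≡ β (target a) × posA a < segStart (α a) windowStart × posA a ≤ y × y ≤ segStart (α a) (col a) + outIndexℕ (α a) (col a))
         ⊎ (¬ Direct a × ¬ α a ≡ β (target a) × segStart (α a) windowEnd ≤ posA a × (posA a ≤ y ⊎ y ≤ segStart (α a) (col a) + outIndexℕ (α a) (col a)))

  TargetZone : Fin k → ℕ → Set
  TargetZone a y = ¬ Direct a × ¬ α a ≡ β (target a) × (segStart (β (target a)) (col a) ≤ y ⊎ y ≤ posB (target a))

  ColumnZone : Fin k → Point → Set
  ColumnZone a x = ¬ Direct a × ¬ α a ≡ β (target a) × (InColumn (col a) (α a) (β (target a)) x ⊎ InColumn (col a) (β (target a)) (α a) x)

  Occupies : Fin k → Point → Set
  Occupies a x = (OnRow (α a) x × SourceZone a (position x)) ⊎ (OnRow (β (target a)) x × TargetZone a (position x)) ⊎ ColumnZone a x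

  crossing : ∀ a' i x → ¬ Direct a' → OnRow i x → (InColumn (col a') (α a') (β (target a')) x ⊎ InColumn (col a') (β (target a')) (α a') x) →
              Between (α a') (β (target a')) i × segStart i 1 ≤ position x × segStart i (col a') ≤ position x × position x < segStart i (suc (col a')) × position x < segStart i windowEnd
  crossing a' i x nd' oi vt = btw , ≤-trans (segStart-mono i (≤-trans (s≤s z≤n) (≤-trans 2≤windowStart (proj₁ (col-window a' nd'))))) l , l ,
                                 ≤-<-trans u (inBlock<segStart-suc i (col a')) , <-≤-trans (≤-<-trans u (inBlock<segStart-suc i (col a'))) (segStart-mono i (proj₂ (col-window a' nd')))
    where
    R = Between (α a') (β (target a')) i × segStart i (col a') ≤ position x × position x ≤ segStart i (col a') + outIndexℕ i (col a')
    r : (InColumn (col a') (α a') (β (target a')) x ⊎ InColumn (col a') (β (target a')) (α a') x) → R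
    r (inj₁ vv) = let t = InColumn-OnRow (col a') (α a') (β (target a')) i x oi vv in
                  inj₁ (proj₁ t , proj₁ (proj₂ t)) , proj₁ (proj₂ (proj₂ t)) , proj₂ (proj₂ (proj₂ t))
    r (inj₂ vv) = let t = InColumn-OnRow (col a') (β (target a')) (α a') i x oi vv in
                  inj₂ (proj₁ t , proj₁ (proj₂ t)) , proj₁ (proj₂ (proj₂ t)) , proj₂ (proj₂ (proj₂ t))
    btw = proj₁ (r vt)
    l = proj₁ (proj₂ (r vt))
    u = proj₂ (proj₂ (r vt))

  source-column-disjoint : ∀ a a' x → OnRow (α a) x → SourceZone a (position x) → ColumnZone a' x → ⊥
  source-column-disjoint a a' x oa za (nd' , nm' , vt) = byZone za
    where
    crossingFacts = crossing a' (α a) x nd' oa vt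
    btw : Between (α a') (β (target a')) (α a)
    btw = proj₁ crossingFacts
    l1 : segStart (α a) 1 ≤ position x
    l1 = proj₁ (proj₂ crossingFacts)
    lc : segStart (α a) (col a') ≤ position x
    lc = proj₁ (proj₂ (proj₂ crossingFacts))
    uL : position x < segStart (α a) windowEnd
    uL = proj₂ (proj₂ (proj₂ (proj₂ crossingFacts)))
    beforeTarget : Direct a → position x ≤ posB (target a) → ⊥
    beforeTarget d le = <-irrefl refl (<-≤-trans (≤-<-trans le (subst (λ z → posB (target a) < segStart z 1) (proj₁ (target-direct a d)) (posB<segStart1 (target a)))) l1)
    byZone : SourceZone a (position x) → ⊥
    byZone (inj₁ (d , _ , le)) = beforeTarget d le
    byZone (inj₂ (inj₁ (d , sk , inj₁ le))) = <-irrefl refl (<-≤-trans uL (≤-trans sk le))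
    byZone (inj₂ (inj₁ (d , sk , inj₂ le))) = beforeTarget d le
    byZone (inj₂ (inj₂ (inj₁ (nd , e , _)))) = proj₁ (col-<-when-source-between a a' nd nd' btw) e
    byZone (inj₂ (inj₂ (inj₂ (inj₁ (nd , nm , _ , _ , le))))) =
      <-irrefl refl (<-≤-trans (≤-<-trans le (inBlock<segStart-suc (α a) (col a))) (≤-trans (segStart-mono (α a) (proj₂ (col-<-when-source-between a a' nd nd' btw))) lc))
    byZone (inj₂ (inj₂ (inj₂ (inj₂ (nd , nm , sk , inj₁ le))))) = <-irrefl refl (<-≤-trans uL (≤-trans sk le))
    byZone (inj₂ (inj₂ (inj₂ (inj₂ (nd , nm , sk , inj₂ le))))) =
      <-irrefl refl (<-≤-trans (≤-<-trans le (inBlock<segStart-suc (α a) (col a))) (≤-trans (segStart-mono (α a) (proj₂ (col-<-when-source-between a a' nd nd' btw))) lc))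

  target-column-disjoint : ∀ a a' x → OnRow (β (target a)) x → TargetZone a (position x) → ColumnZone a' x → ⊥
  target-column-disjoint a a' x ob (nd , nm , zb) (nd' , nm' , vt) = byZone zb
    where
    crossingFacts = crossing a' (β (target a)) x nd' ob vt
    btw : Between (α a') (β (target a')) (β (target a))
    btw = proj₁ crossingFacts
    l1 : segStart (β (target a)) 1 ≤ position x
    l1 = proj₁ (proj₂ crossingFacts)
    uc : position x < segStart (β (target a)) (suc (col a'))
    uc = proj₁ (proj₂ (proj₂ (proj₂ crossingFacts)))
    byZone : (segStart (β (target a)) (col a) ≤ position x ⊎ position x ≤ posB (target a)) → ⊥
    byZone (inj₁ le) = <-irrefl refl (<-≤-trans uc (≤-trans (segStart-mono _ (proj₂ (col->-when-target-between a a' nd nd' btw))) le))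
    byZone (inj₂ le) = <-irrefl refl (<-≤-trans (≤-<-trans le (posB<segStart1 (target a))) l1)

  source-target-disjoint : ∀ a a' x → ¬ a ≡ a' → OnRow (α a) x → SourceZone a (position x) → OnRow (β (target a')) x → TargetZone a' (position x) → ⊥
  source-target-disjoint a a' x ne oa za ob (nd' , nm' , zb) = byZone za
    where
    e : α a ≡ β (target a')
    e = OnRow-unique _ _ x oa ob
    same : β (target a) ≡ α a → ⊥
    same e2 = ne (target-injective a a' (βinj _ _ (trans e2 e)))
    nb : ¬ Direct a → ¬ Reach a (target a')
    nb nd = mover-¬Reach a nd (target a') (sym e)
    zb' : segStart (α a) (col a') ≤ position x ⊎ position x ≤ posB (target a')
    zb' = subst (λ z → segStart z (col a') ≤ position x ⊎ position x ≤ posB (target a')) (sym e) zb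
    byZone : SourceZone a (position x) → ⊥
    byZone (inj₁ (d , _)) = same (proj₁ (target-direct a d))
    byZone (inj₂ (inj₁ (d , _))) = same (proj₁ (target-direct a d))
    byZone (inj₂ (inj₂ (inj₁ (nd , e2 , _)))) = same (sym e2)
    byZone (inj₂ (inj₂ (inj₂ (inj₁ (nd , nm , _ , l , u))))) = byTargetZone zb'
      where
      byTargetZone : segStart (α a) (col a') ≤ position x ⊎ position x ≤ posB (target a') → ⊥
      byTargetZone (inj₁ le) = <-irrefl refl (<-≤-trans (≤-<-trans u (inBlock<segStart-suc (α a) (col a))) (≤-trans (segStart-mono (α a) (col-<-when-source≡target a a' ne e nd nd')) le))
      byTargetZone (inj₂ le) = nb nd (inj₁ (≤-trans l le))
    byZone (inj₂ (inj₂ (inj₂ (inj₂ (nd , nm , sk , _))))) = nb nd (inj₂ sk)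

  column-column-disjoint : ∀ a a' x → ¬ a ≡ a' → ColumnZone a x → ColumnZone a' x → ⊥
  column-column-disjoint a a' x ne (nd , nm , vt) (nd' , nm' , vt') = col-injective a a' ne nd nd' (column-unique (columnPart vt) (columnPart vt'))
    where
    columnPart : ∀ {c r1 r2 r3 r4} → InColumn c r1 r2 x ⊎ InColumn c r3 r4 x → (Σ ℕ λ r → OnRung r c x) ⊎ (Σ ℕ λ r → OnRowBetween r (segStart r c) (segStart r c + outIndexℕ r c) x)
    columnPart (inj₁ (inj₁ (r , _ , _ , iv))) = inj₁ (r , iv)
    columnPart (inj₁ (inj₂ (r , _ , _ , ri))) = inj₂ (r , ri)
    columnPart (inj₂ (inj₁ (r , _ , _ , iv))) = inj₁ (r , iv)
    columnPart (inj₂ (inj₂ (r , _ , _ , ri))) = inj₂ (r , ri)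
    column-unique : ∀ {c c'} → (Σ ℕ λ r → OnRung r c x) ⊎ (Σ ℕ λ r → OnRowBetween r (segStart r c) (segStart r c + outIndexℕ r c) x) →
                      (Σ ℕ λ r → OnRung r c' x) ⊎ (Σ ℕ λ r → OnRowBetween r (segStart r c') (segStart r c' + outIndexℕ r c') x) → c ≡ c'
    column-unique (inj₁ (r , iv)) (inj₁ (r' , iv')) = proj₂ (OnRung-unique _ _ _ _ x iv iv')
    column-unique (inj₁ (r , iv)) (inj₂ (r' , (o , _))) = ⊥-elim (OnRung⇒¬OnRow _ _ _ x iv o)
    column-unique (inj₂ (r , (o , _))) (inj₁ (r' , iv)) = ⊥-elim (OnRung⇒¬OnRow _ _ _ x iv o)
    column-unique {c} {c'} (inj₂ (r , (o , l , u))) (inj₂ (r' , (o' , l' , u'))) =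
      byOrder (<-cmp c c') (subst (λ z → segStart z c' ≤ position x) (sym (OnRow-unique r r' x o o')) l')
                        (subst (λ z → position x ≤ segStart z c' + outIndexℕ z c') (sym (OnRow-unique r r' x o o')) u')
      where
      byOrder : Tri (c < c') (c ≡ c') (c' < c) → segStart r c' ≤ position x → position x ≤ segStart r c' + outIndexℕ r c' → c ≡ c'
      byOrder (tri≈ _ eq _) _ _ = eq
      byOrder (tri< lt _ _) l2 _ = ⊥-elim (<-irrefl refl (<-≤-trans (≤-<-trans u (inBlock<segStart-suc r c)) (≤-trans (segStart-mono r lt) l2)))
      byOrder (tri> _ _ gt) _ u2 = ⊥-elim (<-irrefl refl (<-≤-trans (≤-<-trans u2 (inBlock<segStart-suc r c')) (≤-trans (segStart-mono r gt) l)))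

  occupies-disjoint : ∀ a a' x → ¬ a ≡ a' → Occupies a x → Occupies a' x → ⊥
  occupies-disjoint a a' x ne (inj₁ (oa , _)) (inj₁ (oa' , _)) = ne (αinj a a' (OnRow-unique _ _ x oa oa'))
  occupies-disjoint a a' x ne (inj₁ (oa , za)) (inj₂ (inj₁ (ob , zb))) = source-target-disjoint a a' x ne oa za ob zb
  occupies-disjoint a a' x ne (inj₁ (oa , za)) (inj₂ (inj₂ pv)) = source-column-disjoint a a' x oa za pv
  occupies-disjoint a a' x ne (inj₂ (inj₁ (ob , zb))) (inj₁ (oa , za)) = source-target-disjoint a' a x (λ e → ne (sym e)) oa za ob zb
  occupies-disjoint a a' x ne (inj₂ (inj₁ (ob , _))) (inj₂ (inj₁ (ob' , _))) = ne (target-injective a a' (βinj _ _ (OnRow-unique _ _ x ob ob')))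
  occupies-disjoint a a' x ne (inj₂ (inj₁ (ob , zb))) (inj₂ (inj₂ pv)) = target-column-disjoint a a' x ob zb pv
  occupies-disjoint a a' x ne (inj₂ (inj₂ pv)) (inj₁ (oa , za)) = source-column-disjoint a' a x oa za pv
  occupies-disjoint a a' x ne (inj₂ (inj₂ pv)) (inj₂ (inj₁ (ob , zb))) = target-column-disjoint a' a x ob zb pv
  occupies-disjoint a a' x ne (inj₂ (inj₂ pv)) (inj₂ (inj₂ pv')) = column-column-disjoint a a' x ne pv pv'

  col<C : ∀ a → ¬ Direct a → col a < C
  col<C a nd = <-≤-trans (proj₂ (col-window a nd)) windowEnd≤C

  OnRowWrapping⇒OnRow : ∀ {i lo hi x} → OnRowWrapping i lo hi x → OnRow i x
  OnRowWrapping⇒OnRow (inj₁ (o , _)) = o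
  OnRowWrapping⇒OnRow (inj₂ (o , _)) = o

  ColumnZone-avoids-ends : ∀ a i x → ColumnZone a x → OnRow i x → i ≡ α a ⊎ i ≡ β (target a) → ⊥
  ColumnZone-avoids-ends a i x (_ , _ , inj₁ vt) oi (inj₁ refl) = <-irrefl refl (proj₁ (InColumn-OnRow _ _ _ i x oi vt))
  ColumnZone-avoids-ends a i x (_ , _ , inj₁ vt) oi (inj₂ refl) = <-irrefl refl (proj₁ (proj₂ (InColumn-OnRow _ _ _ i x oi vt)))
  ColumnZone-avoids-ends a i x (_ , _ , inj₂ vt) oi (inj₁ refl) = <-irrefl refl (proj₁ (proj₂ (InColumn-OnRow _ _ _ i x oi vt)))
  ColumnZone-avoids-ends a i x (_ , _ , inj₂ vt) oi (inj₂ refl) = <-irrefl refl (proj₁ (InColumn-OnRow _ _ _ i x oi vt))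

  SourcePart TargetPart : Fin k → Point → Set
  SourcePart a x = OnRow (α a) x × SourceZone a (position x)
  TargetPart a x = OnRow (β (target a)) x × TargetZone a (position x)

  Route : Fin k → Set
  Route a = Σ (List Point) (Trail (Occupies a) (ptA a) (ptB (target a)))

  ptB-OnSourceRow : ∀ a → α a ≡ β (target a) → OnRow (α a) (ptB (target a))
  ptB-OnSourceRow a e = subst (λ i → OnRow i (ptB (target a))) (sym e) (ptB-OnRow (target a))

  directRoute : ∀ a → Direct a → Dec (posA a ≤ posB (target a)) → Route a
  directRoute a d (yes A≤B) = _ , Trail-map toSource (runTo-trail (α a) (ptA a) (ptB (target a)) (ptA-OnRow a) onB′ A≤B)
    where
    onB′ = ptB-OnSourceRow a (sym (proj₁ (target-direct a d)))
    toSource : ∀ {x} → OnRowBetween (α a) (posA a) (posB (target a)) x → Occupies a x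
    toSource (o , l , u) = inj₁ (o , inj₁ (d , l , u))
  directRoute a d (no A≰B) = _ , Trail-map toSource (wrapRun-trail (α a) (ptA a) (ptB (target a)) (ptA-OnRow a) onB′ (≰⇒> A≰B))
    where
    onB′ = ptB-OnSourceRow a (sym (proj₁ (target-direct a d)))
    pastWindow : segStart (α a) windowEnd ≤ posA a
    pastWindow = [ (λ A≤B → ⊥-elim (A≰B A≤B)) , (λ p → p) ]′ (proj₂ (target-direct a d))
    toSource : ∀ {x} → OnRowWrapping (α a) (posA a) (posB (target a)) x → Occupies a x
    toSource (inj₁ (o , l , _)) = inj₁ (o , inj₂ (inj₁ (d , pastWindow , inj₁ l)))
    toSource (inj₂ (o , _ , u)) = inj₁ (o , inj₂ (inj₁ (d , pastWindow , inj₂ u)))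

  sameRowRoute : ∀ a → ¬ Direct a → α a ≡ β (target a) → Route a
  sameRowRoute a nd e = _ , Trail-map toSource (wrapRun-trail (α a) (ptA a) (ptB (target a)) (ptA-OnRow a) (ptB-OnSourceRow a e) B<A)
    where
    B<A : posB (target a) < posA a
    B<A = ≰⇒> (λ A≤B → mover-¬Reach a nd (target a) (sym e) (inj₁ A≤B))
    toSource : ∀ {x} → OnRowWrapping (α a) (posA a) (posB (target a)) x → Occupies a x
    toSource (inj₁ (o , l , _)) = inj₁ (o , inj₂ (inj₂ (inj₁ (nd , e , inj₁ l))))
    toSource (inj₂ (o , _ , u)) = inj₁ (o , inj₂ (inj₂ (inj₁ (nd , e , inj₂ u))))

  ptA-pastWindow : ∀ a → ¬ posA a < segStart (α a) windowStart → segStart (α a) windowEnd ≤ posA a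
  ptA-pastWindow a ¬beforeWindow = [ beforeWindow , pastWindow ]′ (window-avoids-A a)
    where
    beforeWindow : colA a < windowStart → segStart (α a) windowEnd ≤ posA a
    beforeWindow A<L = ⊥-elim (¬beforeWindow (<-≤-trans (proj₂ (position-bounds (α a) (colA a) (offA a) (proj₂ (proj₂ (proj₂ (ptA-OnRow a))))))
                                                      (segStart-mono (α a) A<L)))
    pastWindow : windowEnd ≤ colA a → segStart (α a) windowEnd ≤ posA a
    pastWindow E≤A = ≤-trans (segStart-mono (α a) E≤A) (m≤m+n (segStart (α a) (colA a)) (offA a))

  module Mover (a : Fin k) (nd : ¬ Direct a) (nm : ¬ α a ≡ β (target a)) where
    c : ℕ
    c = col a
    b : Fin k
    b = target a

    cc : c < C
    cc = col<C a nd

    exitPt entryPt : Point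
    exitPt = rowPt (α a) c (outIndexℕ (α a) c)
    entryPt = rowPt (β b) c 0

    sourceLeg : Dec (posA a < segStart (α a) windowStart) → Σ (List Point) (Trail (SourcePart a) (ptA a) exitPt)
    sourceLeg (yes beforeWindow) =
      _ , Trail-map toSource (runTo-trail (α a) (ptA a) exitPt (ptA-OnRow a) (outPt-OnRow (α a) c (α<W a) cc) A≤exit)
      where
      A≤exit : posA a ≤ position exitPt
      A≤exit = ≤-trans (<⇒≤ beforeWindow) (≤-trans (segStart-mono (α a) (proj₁ (col-window a nd))) (m≤m+n _ _))
      toSource : ∀ {x} → OnRowBetween (α a) (posA a) (position exitPt) x → SourcePart a x
      toSource (o , l , u) = o , inj₂ (inj₂ (inj₂ (inj₁ (nd , nm , beforeWindow , l , u))))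
    sourceLeg (no ¬beforeWindow) =
      _ , Trail-map toSource (wrapRun-trail (α a) (ptA a) exitPt (ptA-OnRow a) (outPt-OnRow (α a) c (α<W a) cc) exit<A)
      where
      pastWindow : segStart (α a) windowEnd ≤ posA a
      pastWindow = ptA-pastWindow a ¬beforeWindow
      exit<A : position exitPt < posA a
      exit<A = <-≤-trans (inBlock<segStart-suc (α a) c) (≤-trans (segStart-mono (α a) (proj₂ (col-window a nd))) pastWindow)
      toSource : ∀ {x} → OnRowWrapping (α a) (posA a) (position exitPt) x → SourcePart a x
      toSource (inj₁ (o , l , _)) = o , inj₂ (inj₂ (inj₂ (inj₂ (nd , nm , pastWindow , inj₁ l))))
      toSource (inj₂ (o , _ , u)) = o , inj₂ (inj₂ (inj₂ (inj₂ (nd , nm , pastWindow , inj₂ u))))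

    targetLeg : Σ (List Point) (Trail (TargetPart a) entryPt (ptB b))
    targetLeg = _ , Trail-map toTarget (wrapRun-trail (β b) entryPt (ptB b) (refl , β<W b , cc , s≤s z≤n) (ptB-OnRow b) B<entry)
      where
      B<entry : posB b < position entryPt
      B<entry = <-≤-trans (posB<segStart1 b)
                  (≤-trans (segStart-mono (β b) (≤-trans (s≤s z≤n) (≤-trans 2≤windowStart (proj₁ (col-window a nd))))) (m≤m+n _ _))
      toTarget : ∀ {x} → OnRowWrapping (β b) (position entryPt) (posB b) x → TargetPart a x
      toTarget (inj₁ (o , l , _)) = o , nd , nm , inj₁ (≤-trans (m≤m+n _ 0) l)
      toTarget (inj₂ (o , _ , u)) = o , nd , nm , inj₂ u

    ColumnLeg : Set
    ColumnLeg = Σ (List Point) λ V →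
      (∀ rest → Walk (map vertexAt (entryPt ∷ rest)) → Walk (map vertexAt (exitPt ∷ V ++ entryPt ∷ rest)))
      × Unique V × All (ColumnZone a) V

    columnLeg : Dec (α a < β b) → ColumnLeg
    columnLeg (yes α<β) =
      columnDown c (α a) d , walk , columnDown-Unique c (α a) d α+1+d<W cc , All.map zone (columnDown-InColumn c (α a) d α+1+d<W cc)
      where
      d : ℕ
      d = β b ∸ suc (α a)
      α+1+d≡β : suc (α a + d) ≡ β b
      α+1+d≡β = m+[n∸m]≡n α<β
      α+1+d<W : suc (α a + d) < W
      α+1+d<W = subst (_< W) (sym α+1+d≡β) (β<W b)
      walk : ∀ rest → Walk (map vertexAt (entryPt ∷ rest)) → Walk (map vertexAt (exitPt ∷ columnDown c (α a) d ++ entryPt ∷ rest))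
      walk rest w = subst (λ r → Walk (map vertexAt (exitPt ∷ columnDown c (α a) d ++ rowPt r c 0 ∷ rest))) α+1+d≡β
        (columnDown-Walk c (α a) d rest α+1+d<W cc (col-even a α<β) (subst (λ r → Walk (map vertexAt (rowPt r c 0 ∷ rest))) (sym α+1+d≡β) w))
      zone : ∀ {x} → InColumn c (α a) (suc (α a + d)) x → ColumnZone a x
      zone {x} x∈ = nd , nm , inj₁ (subst (λ r → InColumn c (α a) r x) α+1+d≡β x∈)
    columnLeg (no α≮β) =
      columnUp c (β b) d , walk , columnUp-Unique c (β b) d β+1+d<W cc , All.map zone (columnUp-InColumn c (β b) d β+1+d<W cc)
      where
      d : ℕ
      d = α a ∸ suc (β b)
      β+1+d≡α : suc (β b + d) ≡ α a
      β+1+d≡α = m+[n∸m]≡n (≤∧≢⇒< (≮⇒≥ α≮β) (λ β≡α → nm (sym β≡α)))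
      β+1+d<W : suc (β b + d) < W
      β+1+d<W = subst (_< W) (sym β+1+d≡α) (α<W a)
      walk : ∀ rest → Walk (map vertexAt (entryPt ∷ rest)) → Walk (map vertexAt (exitPt ∷ columnUp c (β b) d ++ entryPt ∷ rest))
      walk rest w = subst (λ r → Walk (map vertexAt (rowPt r c (outIndexℕ r c) ∷ columnUp c (β b) d ++ entryPt ∷ rest))) β+1+d≡α
        (columnUp-Walk c (β b) d rest β+1+d<W cc (col-odd a α≮β) w)
      zone : ∀ {x} → InColumn c (β b) (suc (β b + d)) x → ColumnZone a x
      zone {x} x∈ = nd , nm , inj₂ (subst (λ r → InColumn c (β b) r x) β+1+d≡α x∈)

    routeVia : ColumnLeg → Route a
    routeVia (V , V-walk , V-unique , V-zone) =
      _ , Trail-map fromBridge (Trail-bridge V (proj₂ (sourceLeg (posA a <? segStart (α a) windowStart))) V-walk V-unique V-zone (proj₂ targetLeg)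
                                 source-column source-target column-target)
      where
      fromBridge : ∀ {x} → SourcePart a x ⊎ ColumnZone a x ⊎ TargetPart a x → Occupies a x
      fromBridge (inj₁ x) = inj₁ x
      fromBridge (inj₂ (inj₁ x)) = inj₂ (inj₂ x)
      fromBridge (inj₂ (inj₂ x)) = inj₂ (inj₁ x)
      source-column : ∀ x → SourcePart a x → ColumnZone a x → ⊥
      source-column x (ox , _) zx = ColumnZone-avoids-ends a (α a) x zx ox (inj₁ refl)
      source-target : ∀ x → SourcePart a x → TargetPart a x → ⊥
      source-target x (ox , _) (ox′ , _) = nm (OnRow-unique _ _ x ox ox′)
      column-target : ∀ x → ColumnZone a x → TargetPart a x → ⊥
      column-target x zx (ox , _) = ColumnZone-avoids-ends a (β b) x zx ox (inj₂ refl)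

    route : Route a
    route = routeVia (columnLeg (α a <? β b))

  route : ∀ a → Route a
  route a = byKind (direct? a) (α a ≟ β (target a))
    where
    byKind : Dec (Direct a) → Dec (α a ≡ β (target a)) → Route a
    byKind (yes d) _ = directRoute a d (posA a ≤? posB (target a))
    byKind (no nd) (yes e) = sameRowRoute a nd e
    byKind (no nd) (no nm) = Mover.route a nd nm

  Occupies⇒Valid : ∀ a x → Occupies a x → Valid x
  Occupies⇒Valid a x (inj₁ (o , _)) = OnRow⇒Valid _ x o
  Occupies⇒Valid a x (inj₂ (inj₁ (o , _))) = OnRow⇒Valid _ x o
  Occupies⇒Valid a x (inj₂ (inj₂ (_ , _ , inj₁ (inj₁ (r , _ , _ , (t , refl , vv)))))) = vv
  Occupies⇒Valid a x (inj₂ (inj₂ (_ , _ , inj₁ (inj₂ (r , _ , _ , (o , _)))))) = OnRow⇒Valid _ x o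
  Occupies⇒Valid a x (inj₂ (inj₂ (_ , _ , inj₂ (inj₁ (r , _ , _ , (t , refl , vv)))))) = vv
  Occupies⇒Valid a x (inj₂ (inj₂ (_ , _ , inj₂ (inj₂ (r , _ , _ , (o , _)))))) = OnRow⇒Valid _ x o

  map-coords-vertexAt : ∀ {Q : Point → Set} l → All Q l → (∀ x → Q x → Valid x) → map coords (map vertexAt l) ≡ l
  map-coords-vertexAt [] [] valid = refl
  map-coords-vertexAt (x ∷ l) (qx ∷ ql) valid = cong₂ _∷_ (coords-vertexAt x (valid x qx)) (map-coords-vertexAt l ql valid)

  trailOf : ∀ a → Trail (Occupies a) (ptA a) (ptB (target a)) (proj₁ (route a))
  trailOf a = proj₂ (route a)

  path : Fin k → List⁺ (WV W s)
  path a = vertexAt (ptA a) ∷ map vertexAt (proj₁ (route a))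

  path-IsPath : ∀ a → IsPath W s (path a)
  path-IsPath a = trail-walk (trailOf a) ,
    Uq.map⁻ (subst Unique (sym (map-coords-vertexAt _ (trail-all (trailOf a)) (Occupies⇒Valid a))) (trail-unique (trailOf a)))

  path-member : ∀ a x → x ∈ toList (path a) → Σ Point λ p → Occupies a p × coords x ≡ p
  path-member a x x∈ = occupied (∈-map⁻ vertexAt x∈)
    where
    occupied : (Σ Point λ p → p ∈ ptA a ∷ proj₁ (route a) × x ≡ vertexAt p) → Σ Point λ p → Occupies a p × coords x ≡ p
    occupied (p , p∈ , x≡) = p , occ , trans (cong coords x≡) (coords-vertexAt p (Occupies⇒Valid a p occ))
      where occ = All.lookup (trail-all (trailOf a)) p∈

  path-disjoint : ∀ a a′ → a ≢ a′ → VertexDisjoint (path a) (path a′)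
  path-disjoint a a′ a≢a′ x x∈ x∈′ = clash (path-member a x x∈) (path-member a′ x x∈′)
    where
    clash : (Σ Point λ p → Occupies a p × coords x ≡ p) → (Σ Point λ p → Occupies a′ p × coords x ≡ p) → ⊥
    clash (p , occ , x≡p) (p′ , occ′ , x≡p′) = occupies-disjoint a a′ p a≢a′ occ (subst (Occupies a′) (trans (sym x≡p′) x≡p) occ′)

  path-head : ∀ a → head (path a) ≡ A a
  path-head = vertexAt-ptA

  path-last : ∀ a → last (path a) ≡ B (target a)
  path-last a = begin
    last (path a)                                         ≡⟨ last≡lastOf (vertexAt (ptA a)) (map vertexAt t) ⟩
    lastOf (vertexAt (ptA a)) (map vertexAt t)            ≡⟨ lastOf-map vertexAt (ptA a) t ⟩
    vertexAt (lastOf (ptA a) t)                           ≡⟨ cong vertexAt (trail-last (trailOf a)) ⟩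
    vertexAt (ptB (target a))                             ≡⟨ vertexAt-ptB (target a) ⟩
    B (target a)                                          ∎
    where
    t = proj₁ (route a)
    open ≡-Reasoning

lemma9p3 : (k w : ℕ) → 3 ≤ k → 3 ≤ w → 2 * k * (k + 2) ≤ w →
    (s : Subdiv w) →
    (A : Fin k → WV w s) → (∀ (a b : Fin k) → A a ≡ A b → a ≡ b) →
    (Σ (Fin k → Fin w) λ cA → ((∀ (a b : Fin k) → cA a ≡ cA b → a ≡ b) × (∀ a → OnCycle w s (A a) (cA a)))) →
    (B : Fin k → WV w s) → (∀ (a b : Fin k) → B a ≡ B b → a ≡ b) →
    (∀ b → OnP11 w s (B b)) →
    (Σ (Fin k → Fin w) λ cB → ((∀ (a b : Fin k) → cB a ≡ cB b → a ≡ b) × (∀ b → OnCycle w s (B b) (cB b)))) →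
    Σ (Fin k → List⁺ (WV w s)) λ P → ((∀ a → IsPath w s (P a))
    × (∀ (a b : Fin k) → a ≢ b → VertexDisjoint (P a) (P b))
    × (∀ a → Σ (Fin k) λ a' → head (P a) ≡ A a')
    × (∀ a → Σ (Fin k) λ b' → last (P a) ≡ B b'))
lemma9p3 k (suc w0) 3≤k (s≤s _) 2k[k+2]≤w s A _ (cycleA , cycleA-injective , A-onCycle) B _ B-onP11 (cycleB , cycleB-injective , B-onCycle) =
  path , path-IsPath , path-disjoint , (λ a → a , path-head a) , (λ a → target a , path-last a)
  where
  open Routing w0 s k (≤-trans (s≤s z≤n) 3≤k) 2k[k+2]≤w A cycleA cycleA-injective A-onCycle B cycleB cycleB-injective B-onP11 B-onCycle
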